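{- Let $M$ be an $n\times n$ positive definite symmetric integral matrix, $a$ an integer, $B\in M_{n\times n}(\mathbb Z)$, $\mathbf w,\mathbf s=(s_1,\dots,s_n)\in\mathbb Z^n$ with $\mathcal M_{B,\mathbf w}^{\mathbf s}\ne\emptyset$. Then: (i) $r_{B,\mathbf 0}^{\mathbf s}(a,M)=r(a,M_{B,\mathbf 0}^{\mathbf s})$. (ii) If $d_{B,\mathbf w}^{\mathbf s}=2$, then $r_{B,\mathbf w}^{\mathbf s}(a,M)=r(a,\widetilde{M_{B,\mathbf w}^{\mathbf s}})-r(a,M_{B,\mathbf 0}^{\mathbf s})$. (iii) The map $\mathbf x\mapsto-\mathbf x$ is a bijection from $R_{B,\mathbf w}^{\mathbf s}(a,M)$ to $R_{B,-\mathbf w}^{\mathbf s}(a,M)$. In particular, if $d_{B,\mathbf w}^{\mathbf s}=3$, then $r_{B,\mathbf w}^{\mathbf s}(a,M)=\frac12\big(r(a,\widetilde{M_{B,\mathbf w}^{\mathbf s}})-r(a,M_{B,\mathbf 0}^{\mathbf s})\big)$. (iv) Let $s=\gcd(s_1,\dots,s_n)$ and assume $\gcd(\det B,s)=\gcd(a,s)=1$. Then for every integer $k$ with $\gcd(s,k)>1$, $r_{B,k\mathbf w}^{\mathbf s}(a,M)=0$.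
   Context: For $\mathbf w,\mathbf w',\mathbf s=(s_i)\in\mathbb Z^n$ (all $s_i\ne0$), $\mathbf w\equiv\mathbf w'\pmod{\mathbf s}$ means $w_i\equiv w'_i\pmod{s_i}$ for all $i$. $\mathcal M_{B,\mathbf w}^{\mathbf s}=\{\mathbf x\in\mathbb Z^n:B\mathbf x\equiv\mathbf w\pmod{\mathbf s}\}$. Let $\mathcal U$ be a matrix whose columns form a $\mathbb Z$-basis of the rank-$n$ free module $\mathcal M_{B,\mathbf 0}^{\mathbf s}$ and $M_{B,\mathbf 0}^{\mathbf s}=\mathcal U^tM\mathcal U$. Fix $\mathbf y\in\mathcal M_{B,\mathbf w}^{\mathbf s}$; $\widetilde{\mathcal M_{B,\mathbf w}^{\mathbf s}}=\mathbb Z\mathbf y+\mathcal M_{B,\mathbf 0}^{\mathbf s}$, $d_{B,\mathbf w}^{\mathbf s}=[\widetilde{\mathcal M_{B,\mathbf w}^{\mathbf s}}:\mathcal M_{B,\mathbf 0}^{\mathbf s}]$, and $\widetilde{M_{B,\mathbf w}^{\mathbf s}}=\widetilde{\mathcal V}^tM\widetilde{\mathcal V}$ where the columns of $\widetilde{\mathcal V}$ form a $\mathbb Z$-basis of $\widetilde{\mathcal M_{B,\mathbf w}^{\mathbf s}}$. $R_{B,\mathbf w}^{\mathbf s}(a,M)=\{\mathbf x\in\mathcal M_{B,\mathbf w}^{\mathbf s}:\mathbf x^tM\mathbf x=a\}$, $r_{B,\mathbf w}^{\mathbf s}(a,M)=|R_{B,\mathbf w}^{\mathbf s}(a,M)|$,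 and $r(a,N)=|\{\mathbf x\in\mathbb Z^n:\mathbf x^tN\mathbf x=a\}|$. -}

module Defs where

open import Data.Nat using (ℕ; zero; suc)
open import Data.Fin using (Fin; zero; suc; punchIn)
open import Data.Integer using (ℤ; +_; _+_; _*_; -_; _-_; _<_; 0ℤ)
open import Data.Integer.Divisibility using (_∣_)
open import Data.Integer.GCD using (gcd)
open import Data.Vec using (Vec; lookup; tabulate; replicate; map)
open import Data.List using (List; length)
open import Data.List.Membership.Propositional using (_∈_)
open import Data.List.Relation.Unary.Unique.Propositional using (Unique)
open import Data.Product using (Σ; ∃; _×_)
open import Function.Bundles using (_⇔_)
open import Relation.Binary.PropositionalEquality using (_≡_)
open import Relation.Nullary using (¬_)

Mat : ℕ → Set
Mat n = Fin n → Fin n → ℤ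

Vecℤ : ℕ → Set
Vecℤ n = Vec ℤ n

∑ : (n : ℕ) → (Fin n → ℤ) → ℤ
∑ zero    f = 0ℤ
∑ (suc n) f = f zero + ∑ n (λ i → f (suc i))

_*ᵥ_ : {n : ℕ} → Mat n → Vecℤ n → Vecℤ n
_*ᵥ_ {n} A x = tabulate (λ i → ∑ n (λ j → A i j * lookup x j))

_·ᵥ_ : {n : ℕ} → ℤ → Vecℤ n → Vecℤ n
k ·ᵥ x = map (k *_) x

negᵥ : {n : ℕ} → Vecℤ n → Vecℤ n
negᵥ x = map -_ x

0ᵥ : {n : ℕ} → Vecℤ n
0ᵥ = replicate _ 0ℤ

_+ᵥ_ : {n : ℕ} → Vecℤ n → Vecℤ n → Vecℤ n
_+ᵥ_ {n} x y = tabulate (λ i → lookup x i + lookup y i)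

_-ᵥ_ : {n : ℕ} → Vecℤ n → Vecℤ n → Vecℤ n
_-ᵥ_ {n} x y = tabulate (λ i → lookup x i - lookup y i)

col : {n : ℕ} → Mat n → Fin n → Vecℤ n
col A j = tabulate (λ i → A i j)

Q : {n : ℕ} → Mat n → Vecℤ n → ℤ
Q {n} M x = ∑ n (λ i → ∑ n (λ j → lookup x i * M i j * lookup x j))

congr : {n : ℕ} → Mat n → Mat n → Mat n
congr {n} M U i j = ∑ n (λ k → ∑ n (λ l → U k i * M k l * U l j))

Symmetric : {n : ℕ} → Mat n → Set
Symmetric M = ∀ i j → M i j ≡ M j i

-- positive definite (tested on nonzero integer vectors; equivalent to the real
-- notion for integral symmetric matrices)
PosDef : {n : ℕ} → Mat n → Set
PosDef M = ∀ x → ¬ (x ≡ 0ᵥ) → 0ℤ < Q M x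

sgn : {n : ℕ} → Fin n → ℤ
sgn zero          = + 1
sgn (suc zero)    = - (+ 1)
sgn (suc (suc i)) = sgn i

det : (n : ℕ) → Mat n → ℤ
det zero    A = + 1
det (suc n) A = ∑ (suc n) (λ j → sgn j * A zero j * det n (λ k l → A (suc k) (punchIn j l)))

-- gcd of the entries of a vector (gcd of empty family = 0)
gcdᵥ : (n : ℕ) → Vecℤ n → ℤ
gcdᵥ zero    s = 0ℤ
gcdᵥ (suc n) s = gcd (lookup s zero) (gcdᵥ n (tabulate (λ i → lookup s (suc i))))

_≡_[mod_] : {n : ℕ} → Vecℤ n → Vecℤ n → Vecℤ n → Set
w ≡ w' [mod s ] = ∀ i → lookup s i ∣ (lookup w i - lookup w' i)

𝓜 : {n : ℕ} → Mat n → Vecℤ n → Vecℤ n → Vecℤ n → Set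
𝓜 B w s x = (B *ᵥ x) ≡ w [mod s ]

ℤ·_⊕_ : {n : ℕ} → Vecℤ n → (Vecℤ n → Set) → Vecℤ n → Set
(ℤ· y ⊕ L) x = Σ ℤ λ t → Σ (Vecℤ _) λ m → L m × (x ≡ (t ·ᵥ y) +ᵥ m)

IsBasis : {n : ℕ} → Mat n → (Vecℤ n → Set) → Set
IsBasis U L = (∀ j → L (col U j))
            × (∀ x → L x → ∃ λ c → U *ᵥ c ≡ x)
            × (∀ c c' → U *ᵥ c ≡ U *ᵥ c' → c ≡ c')

HasCard : {n : ℕ} → (Vecℤ n → Set) → ℕ → Set
HasCard {n} P k = Σ (List (Vecℤ n)) λ xs → Unique xs × length xs ≡ k × (∀ x → (x ∈ xs) ⇔ P x)

R : {n : ℕ} → Mat n → Vecℤ n → Vecℤ n → ℤ → Mat n → Vecℤ n → Set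
R B w s a M x = 𝓜 B w s x × Q M x ≡ a

Rep : {n : ℕ} → ℤ → Mat n → Vecℤ n → Set
Rep a N x = Q N x ≡ a

-- the index [L : L'] (L' ⊆ L) equals d: there are d representatives in L of
-- pairwise distinct cosets of L' that exhaust L
HasIndex : {n : ℕ} → (Vecℤ n → Set) → (Vecℤ n → Set) → ℕ → Set
HasIndex {n} L L' d = Σ (Fin d → Vecℤ n) λ f →
    (∀ i → L (f i))
  × (∀ i j → L' (f i -ᵥ f j) → i ≡ j)
  × (∀ x → L x → ∃ λ i → L' (x -ᵥ f i))

{-# OPTIONS --safe #-}
-- Every x ∈ ℤⁿ with Q x ≤ b has bounded coordinates (complete the square against the first
-- coordinate and induct on the Schur complement), so all representation sets below are finite.
-- A basis U of a submodule P turns the representations of a by UᵗMU bijectively into those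
-- of a by M lying in P; this gives (i). 𝓜_{B,w} is the coset y + L of L = 𝓜_{B,0}, and if
-- ℤy ⊕ L has index 2 (resp. 3) its cosets are L and y + L (resp. L, y + L and −y + L = 𝓜_{B,−w}),
-- so counting representations in ℤy ⊕ L coset by coset, with x ↦ −x matching y + L and −y + L,
-- gives (ii) and (iii). For (iv), g = gcd(s, k) divides B x; Cramer's rule and gcd(det B, g) = 1
-- make g divide every xⱼ, hence Q x = a, so g = 1.
module Submission where

open import Defs
open import Data.Nat as ℕ using (ℕ; zero; suc)
import Data.Nat.Properties as ℕ
import Data.Nat.Divisibility as ℕ
import Data.Nat.GCD as ℕ
import Data.Nat.Coprimality as ℕ
open import Data.Fin as Fin using (Fin; zero; suc; punchIn; punchOut; inject₁; toℕ)
import Data.Fin.Properties as Fin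
open import Data.Integer as ℤ
  using (ℤ; +_; -[1+_]; _+_; _*_; -_; _-_; 0ℤ; 1ℤ; ∣_∣; _≤_; _<_; +≤+; +<+)
open import Data.Integer.Properties
open import Data.Integer.DivMod using (_/ℕ_; n%ℕd<d; a≡a%ℕn+[a/ℕn]*n)
open import Data.Integer.Divisibility.Signed
  using (_∣_; divides; ∣ᵤ⇒∣; ∣⇒∣ᵤ; ∣-trans; ∣m∣n⇒∣m+n; ∣n⇒∣m*n; ∣m⇒∣m*n)
open import Data.Integer.GCD using (gcd; gcd[i,j]∣i; gcd[i,j]∣j; gcd-greatest)
open import Data.Integer.Tactic.RingSolver using (solve-∀)
open import Data.Vec using (Vec; []; _∷_; lookup; tabulate)
import Data.Vec.Properties as Vec
open import Data.List as List using (List; []; _∷_; length; filter; deduplicate; concatMap)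
open import Data.List.Membership.Propositional using (_∈_; lose)
open import Data.List.Membership.Propositional.Properties
  using (∈-concatMap⁺; ∈-filter⁺; ∈-filter⁻; ∈-map⁺; ∈-map⁻; ∈-deduplicate⁺; ∈-deduplicate⁻)
open import Data.List.Membership.Propositional.Properties.WithK using (unique∧set⇒bag)
open import Data.List.Relation.Unary.Any using (here; there)
open import Data.List.Relation.Unary.Unique.Propositional using (Unique)
import Data.List.Relation.Unary.Unique.Propositional.Properties as Unique
open import Data.List.Relation.Unary.Unique.DecPropositional.Properties using (deduplicate-!)
open import Data.List.Relation.Binary.BagAndSetEquality using (∼bag⇒↭)
open import Data.List.Relation.Binary.Permutation.Propositional.Properties using (↭-length)
import Data.List.Properties as List
open import Data.Product using (Σ; ∃; ∃₂; _×_; _,_; proj₁; proj₂)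
open import Data.Bool using (if_then_else_)
open import Data.Sum using (inj₁; inj₂)
open import Function using (_∘_; mk⇔; Equivalence)
open import Function.Definitions using (Injective)
open import Relation.Nullary using (¬_; yes; no; does; contradiction)
open import Relation.Nullary.Decidable using (¬?)
open import Relation.Unary using (Decidable)
open import Relation.Binary.Definitions using (tri<; tri≈; tri>)
open import Relation.Binary.PropositionalEquality

∑-cong : ∀ n {f g : Fin n → ℤ} → (∀ i → f i ≡ g i) → ∑ n f ≡ ∑ n g
∑-cong zero    e = refl
∑-cong (suc n) e = cong₂ _+_ (e zero) (∑-cong n (e ∘ suc))

∑-zero : ∀ n → ∑ n (λ _ → 0ℤ) ≡ 0ℤ
∑-zero zero    = refl
∑-zero (suc n) = trans (+-identityˡ _) (∑-zero n)

∑-distrib-+ : ∀ n (f g : Fin n → ℤ) → ∑ n (λ i → f i + g i) ≡ ∑ n f + ∑ n g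
∑-distrib-+ zero    f g = refl
∑-distrib-+ (suc n) f g =
  trans (cong (_+_ (f zero + g zero)) (∑-distrib-+ n (f ∘ suc) (g ∘ suc)))
        (+-interchange (f zero) (g zero) _ _)
  where
  +-interchange : ∀ a b c d → (a + b) + (c + d) ≡ (a + c) + (b + d)
  +-interchange = solve-∀

*-distribˡ-∑ : ∀ n c (f : Fin n → ℤ) → ∑ n (λ i → c * f i) ≡ c * ∑ n f
*-distribˡ-∑ zero    c f = sym (*-zeroʳ c)
*-distribˡ-∑ (suc n) c f =
  trans (cong (_+_ (c * f zero)) (*-distribˡ-∑ n c (f ∘ suc))) (sym (*-distribˡ-+ c (f zero) _))

*-distribʳ-∑ : ∀ n c (f : Fin n → ℤ) → ∑ n (λ i → f i * c) ≡ ∑ n f * c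
*-distribʳ-∑ n c f =
  trans (∑-cong n (λ i → *-comm (f i) c)) (trans (*-distribˡ-∑ n c f) (*-comm c _))

neg-distrib-∑ : ∀ n (f : Fin n → ℤ) → ∑ n (λ i → - f i) ≡ - ∑ n f
neg-distrib-∑ zero    f = refl
neg-distrib-∑ (suc n) f =
  trans (cong (_+_ (- f zero)) (neg-distrib-∑ n (f ∘ suc))) (sym (neg-distrib-+ (f zero) _))

∑-comm : ∀ n m (f : Fin n → Fin m → ℤ) →
         ∑ n (λ i → ∑ m (f i)) ≡ ∑ m (λ j → ∑ n (λ i → f i j))
∑-comm zero    m f = sym (∑-zero m)
∑-comm (suc n) m f =
  trans (cong (_+_ (∑ m (f zero))) (∑-comm n m (f ∘ suc)))
        (sym (∑-distrib-+ m (f zero) (λ j → ∑ n (λ i → f (suc i) j))))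

∑-*-∑ : ∀ n m (f : Fin n → ℤ) (g : Fin m → ℤ) → ∑ n f * ∑ m g ≡ ∑ n (λ i → ∑ m (λ j → f i * g j))
∑-*-∑ n m f g = trans (sym (*-distribʳ-∑ n (∑ m g) f)) (∑-cong n (λ i → sym (*-distribˡ-∑ m (f i) g)))

∑-single : ∀ n (f : Fin n → ℤ) j → (∀ i → i ≢ j → f i ≡ 0ℤ) → ∑ n f ≡ f j
∑-single (suc n) f zero    f≡0 =
  trans (cong (_+_ (f zero)) (trans (∑-cong n (λ i → f≡0 (suc i) λ ())) (∑-zero n))) (+-identityʳ _)
∑-single (suc n) f (suc j) f≡0 =
  trans (cong (_+ ∑ n (f ∘ suc)) (f≡0 zero λ ())) (trans (+-identityˡ _)
        (∑-single n (f ∘ suc) j (λ i i≢j → f≡0 (suc i) (i≢j ∘ Fin.suc-injective))))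

∑-∣ : ∀ n {g} (f : Fin n → ℤ) → (∀ i → g ∣ f i) → g ∣ ∑ n f
∑-∣ zero    f g∣f = divides 0ℤ refl
∑-∣ (suc n) f g∣f = ∣m∣n⇒∣m+n (g∣f zero) (∑-∣ n (f ∘ suc) (g∣f ∘ suc))

lookup-ext : ∀ {n} {x y : Vecℤ n} → (∀ i → lookup x i ≡ lookup y i) → x ≡ y
lookup-ext {x = x} {y} e =
  trans (sym (Vec.tabulate∘lookup x)) (trans (Vec.tabulate-cong e) (Vec.tabulate∘lookup y))

module _ {n : ℕ} where

  lookup-*ᵥ : ∀ (A : Mat n) x i → lookup (A *ᵥ x) i ≡ ∑ n (λ j → A i j * lookup x j)
  lookup-*ᵥ A x = Vec.lookup∘tabulate _

  lookup-·ᵥ : ∀ t (x : Vecℤ n) i → lookup (t ·ᵥ x) i ≡ t * lookup x i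
  lookup-·ᵥ t x i = Vec.lookup-map i _ x

  lookup-negᵥ : ∀ (x : Vecℤ n) i → lookup (negᵥ x) i ≡ - lookup x i
  lookup-negᵥ x i = Vec.lookup-map i _ x

  lookup-0ᵥ : ∀ i → lookup (0ᵥ {n}) i ≡ 0ℤ
  lookup-0ᵥ i = Vec.lookup-replicate i 0ℤ

  lookup-+ᵥ : ∀ (x y : Vecℤ n) i → lookup (x +ᵥ y) i ≡ lookup x i + lookup y i
  lookup-+ᵥ x y = Vec.lookup∘tabulate _

  lookup--ᵥ : ∀ (x y : Vecℤ n) i → lookup (x -ᵥ y) i ≡ lookup x i - lookup y i
  lookup--ᵥ x y = Vec.lookup∘tabulate _

  lookup-col : ∀ (A : Mat n) j i → lookup (col A j) i ≡ A i j
  lookup-col A j = Vec.lookup∘tabulate _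

  negᵥ-involutive : ∀ (x : Vecℤ n) → negᵥ (negᵥ x) ≡ x
  negᵥ-involutive x = lookup-ext λ i →
    trans (lookup-negᵥ (negᵥ x) i) (trans (cong -_ (lookup-negᵥ x i)) (neg-involutive _))

  negᵥ≡-1·ᵥ : ∀ (x : Vecℤ n) → negᵥ x ≡ (- 1ℤ) ·ᵥ x
  negᵥ≡-1·ᵥ x = lookup-ext λ i →
    trans (lookup-negᵥ x i) (trans (sym (-1*i≡-i _)) (sym (lookup-·ᵥ (- 1ℤ) x i)))

  -ᵥ≡+ᵥnegᵥ : ∀ (x y : Vecℤ n) → x -ᵥ y ≡ x +ᵥ negᵥ y
  -ᵥ≡+ᵥnegᵥ x y = lookup-ext λ i →
    trans (lookup--ᵥ x y i) (sym (trans (lookup-+ᵥ x (negᵥ y) i) (cong (_+_ (lookup x i)) (lookup-negᵥ y i))))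

  -ᵥ-self : ∀ (x : Vecℤ n) → x -ᵥ x ≡ 0ᵥ
  -ᵥ-self x = lookup-ext λ i → trans (lookup--ᵥ x x i) (trans (+-inverseʳ (lookup x i)) (sym (lookup-0ᵥ i)))

  -ᵥ-identityʳ : ∀ (x : Vecℤ n) → x -ᵥ 0ᵥ ≡ x
  -ᵥ-identityʳ x = lookup-ext λ i →
    trans (lookup--ᵥ x 0ᵥ i) (trans (cong (λ z → lookup x i - z) (lookup-0ᵥ i)) (+-identityʳ _))

  +ᵥ-identityˡ : ∀ (x : Vecℤ n) → 0ᵥ +ᵥ x ≡ x
  +ᵥ-identityˡ x = lookup-ext λ i →
    trans (lookup-+ᵥ 0ᵥ x i) (trans (cong (_+ lookup x i) (lookup-0ᵥ i)) (+-identityˡ _))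

  ·ᵥ-zeroʳ : ∀ t → t ·ᵥ 0ᵥ {n} ≡ 0ᵥ
  ·ᵥ-zeroʳ t = lookup-ext λ i →
    trans (lookup-·ᵥ t 0ᵥ i) (trans (cong (t *_) (lookup-0ᵥ i)) (trans (*-zeroʳ t) (sym (lookup-0ᵥ i))))

  -ᵥ-+ᵥ-cancel : ∀ (x y : Vecℤ n) → (x -ᵥ y) +ᵥ y ≡ x
  -ᵥ-+ᵥ-cancel x y = lookup-ext λ i →
    trans (lookup-+ᵥ (x -ᵥ y) y i) (trans (cong (_+ lookup y i) (lookup--ᵥ x y i)) (cancel (lookup x i) (lookup y i)))
    where
    cancel : ∀ a b → a - b + b ≡ a
    cancel = solve-∀

  negᵥ-ᵥ : ∀ (x y : Vecℤ n) → negᵥ (x -ᵥ y) ≡ y -ᵥ x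
  negᵥ-ᵥ x y = lookup-ext λ i →
    trans (lookup-negᵥ (x -ᵥ y) i) (trans (cong -_ (lookup--ᵥ x y i))
      (trans (swap (lookup x i) (lookup y i)) (sym (lookup--ᵥ y x i))))
    where
    swap : ∀ a b → - (a - b) ≡ b - a
    swap = solve-∀

  -ᵥ-telescope : ∀ (x y z : Vecℤ n) → (x -ᵥ y) +ᵥ (y -ᵥ z) ≡ x -ᵥ z
  -ᵥ-telescope x y z = lookup-ext λ i →
    trans (lookup-+ᵥ (x -ᵥ y) (y -ᵥ z) i)
      (trans (cong₂ _+_ (lookup--ᵥ x y i) (lookup--ᵥ y z i))
        (trans (telescope (lookup x i) (lookup y i) (lookup z i)) (sym (lookup--ᵥ x z i))))
    where
    telescope : ∀ a b c → (a - b) + (b - c) ≡ a - c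
    telescope = solve-∀

  *ᵥ-distrib-+ᵥ : ∀ (A : Mat n) x y → A *ᵥ (x +ᵥ y) ≡ (A *ᵥ x) +ᵥ (A *ᵥ y)
  *ᵥ-distrib-+ᵥ A x y = lookup-ext λ i → begin
    lookup (A *ᵥ (x +ᵥ y)) i
      ≡⟨ lookup-*ᵥ A (x +ᵥ y) i ⟩
    ∑ n (λ j → A i j * lookup (x +ᵥ y) j)
      ≡⟨ ∑-cong n (λ j → trans (cong (A i j *_) (lookup-+ᵥ x y j)) (*-distribˡ-+ (A i j) _ _)) ⟩
    ∑ n (λ j → A i j * lookup x j + A i j * lookup y j)
      ≡⟨ ∑-distrib-+ n _ _ ⟩
    ∑ n (λ j → A i j * lookup x j) + ∑ n (λ j → A i j * lookup y j)
      ≡⟨ sym (cong₂ _+_ (lookup-*ᵥ A x i) (lookup-*ᵥ A y i)) ⟩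
    lookup (A *ᵥ x) i + lookup (A *ᵥ y) i
      ≡⟨ sym (lookup-+ᵥ (A *ᵥ x) (A *ᵥ y) i) ⟩
    lookup ((A *ᵥ x) +ᵥ (A *ᵥ y)) i ∎
    where open ≡-Reasoning

  *ᵥ-·ᵥ : ∀ (A : Mat n) t x → A *ᵥ (t ·ᵥ x) ≡ t ·ᵥ (A *ᵥ x)
  *ᵥ-·ᵥ A t x = lookup-ext λ i → begin
    lookup (A *ᵥ (t ·ᵥ x)) i
      ≡⟨ lookup-*ᵥ A (t ·ᵥ x) i ⟩
    ∑ n (λ j → A i j * lookup (t ·ᵥ x) j)
      ≡⟨ ∑-cong n (λ j → trans (cong (A i j *_) (lookup-·ᵥ t x j)) (x*[y*z]≡y*[x*z] (A i j) t _)) ⟩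
    ∑ n (λ j → t * (A i j * lookup x j))
      ≡⟨ *-distribˡ-∑ n t _ ⟩
    t * ∑ n (λ j → A i j * lookup x j)
      ≡⟨ cong (t *_) (sym (lookup-*ᵥ A x i)) ⟩
    t * lookup (A *ᵥ x) i
      ≡⟨ sym (lookup-·ᵥ t (A *ᵥ x) i) ⟩
    lookup (t ·ᵥ (A *ᵥ x)) i ∎
    where
    open ≡-Reasoning
    x*[y*z]≡y*[x*z] : ∀ a b c → a * (b * c) ≡ b * (a * c)
    x*[y*z]≡y*[x*z] = solve-∀

  *ᵥ-0ᵥ : ∀ (A : Mat n) → A *ᵥ 0ᵥ ≡ 0ᵥ
  *ᵥ-0ᵥ A = lookup-ext λ i → trans (lookup-*ᵥ A 0ᵥ i)
    (trans (∑-cong n (λ j → trans (cong (A i j *_) (lookup-0ᵥ j)) (*-zeroʳ (A i j))))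
      (trans (∑-zero n) (sym (lookup-0ᵥ i))))

∑ᵥ : ∀ {n} k → (Fin k → Vecℤ n) → Vecℤ n
∑ᵥ zero    v = 0ᵥ
∑ᵥ (suc k) v = v zero +ᵥ ∑ᵥ k (v ∘ suc)

lookup-∑ᵥ : ∀ {n} k (v : Fin k → Vecℤ n) i → lookup (∑ᵥ k v) i ≡ ∑ k (λ j → lookup (v j) i)
lookup-∑ᵥ zero    v i = lookup-0ᵥ i
lookup-∑ᵥ (suc k) v i = trans (lookup-+ᵥ (v zero) (∑ᵥ k (v ∘ suc)) i) (cong (_+_ (lookup (v zero) i)) (lookup-∑ᵥ k (v ∘ suc) i))

*ᵥ≡∑ᵥ-columns : ∀ {n} (A : Mat n) x → A *ᵥ x ≡ ∑ᵥ n (λ j → lookup x j ·ᵥ col A j)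
*ᵥ≡∑ᵥ-columns {n} A x = lookup-ext pointwise
  where
  entry : ∀ i j → lookup (lookup x j ·ᵥ col A j) i ≡ lookup x j * A i j
  entry i j = trans (lookup-·ᵥ (lookup x j) (col A j) i) (cong (lookup x j *_) (lookup-col A j i))
  pointwise : ∀ i → lookup (A *ᵥ x) i ≡ lookup (∑ᵥ n (λ j → lookup x j ·ᵥ col A j)) i
  pointwise i = begin
    lookup (A *ᵥ x) i                              ≡⟨ lookup-*ᵥ A x i ⟩
    ∑ n (λ j → A i j * lookup x j)                 ≡⟨ ∑-cong n (λ j → trans (*-comm (A i j) _) (sym (entry i j))) ⟩
    ∑ n (λ j → lookup (lookup x j ·ᵥ col A j) i)   ≡⟨ sym (lookup-∑ᵥ n _ i) ⟩
    lookup (∑ᵥ n (λ j → lookup x j ·ᵥ col A j)) i ∎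
    where open ≡-Reasoning

module _ {n : ℕ} (s : Vecℤ n) where

  ≡-mod⇒∣ : ∀ {x x'} → x ≡ x' [mod s ] → ∀ i → lookup s i ∣ (lookup x i - lookup x' i)
  ≡-mod⇒∣ x≡x' i = ∣ᵤ⇒∣ (x≡x' i)

  ∣⇒≡-mod : ∀ {x x'} → (∀ i → lookup s i ∣ (lookup x i - lookup x' i)) → x ≡ x' [mod s ]
  ∣⇒≡-mod s∣x-x' i = ∣⇒∣ᵤ (s∣x-x' i)

  ≡-mod-refl : ∀ (x : Vecℤ n) → x ≡ x [mod s ]
  ≡-mod-refl x = ∣⇒≡-mod {x} {x} λ i → subst (lookup s i ∣_) (sym (+-inverseʳ (lookup x i))) (divides 0ℤ refl)

  ≡-mod-+ : ∀ {x x' y y'} → x ≡ x' [mod s ] → y ≡ y' [mod s ] → (x +ᵥ y) ≡ (x' +ᵥ y') [mod s ]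
  ≡-mod-+ {x} {x'} {y} {y'} x≡x' y≡y' = ∣⇒≡-mod {x +ᵥ y} {x' +ᵥ y'} λ i →
    subst (lookup s i ∣_) (sym (eq i)) (∣m∣n⇒∣m+n (≡-mod⇒∣ {x} {x'} x≡x' i) (≡-mod⇒∣ {y} {y'} y≡y' i))
    where
    regroup : ∀ a b c d → (a + c) - (b + d) ≡ (a - b) + (c - d)
    regroup = solve-∀
    eq : ∀ i → lookup (x +ᵥ y) i - lookup (x' +ᵥ y') i ≡ (lookup x i - lookup x' i) + (lookup y i - lookup y' i)
    eq i = trans (cong₂ _-_ (lookup-+ᵥ x y i) (lookup-+ᵥ x' y' i))
                 (regroup (lookup x i) (lookup x' i) (lookup y i) (lookup y' i))

  ≡-mod-· : ∀ t {x x'} → x ≡ x' [mod s ] → (t ·ᵥ x) ≡ (t ·ᵥ x') [mod s ]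
  ≡-mod-· t {x} {x'} x≡x' = ∣⇒≡-mod {t ·ᵥ x} {t ·ᵥ x'} λ i →
    subst (lookup s i ∣_) (sym (eq i)) (∣n⇒∣m*n t (≡-mod⇒∣ {x} {x'} x≡x' i))
    where
    factor : ∀ t a b → t * a - t * b ≡ t * (a - b)
    factor = solve-∀
    eq : ∀ i → lookup (t ·ᵥ x) i - lookup (t ·ᵥ x') i ≡ t * (lookup x i - lookup x' i)
    eq i = trans (cong₂ _-_ (lookup-·ᵥ t x i) (lookup-·ᵥ t x' i)) (factor t (lookup x i) (lookup x' i))

module _ {n : ℕ} (B : Mat n) (s : Vecℤ n) where

  𝓜-+ᵥ : ∀ {u v x y} → 𝓜 B u s x → 𝓜 B v s y → 𝓜 B (u +ᵥ v) s (x +ᵥ y)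
  𝓜-+ᵥ {u} {v} {x} {y} x∈ y∈ =
    subst (λ z → z ≡ (u +ᵥ v) [mod s ]) (sym (*ᵥ-distrib-+ᵥ B x y)) (≡-mod-+ s {B *ᵥ x} {u} {B *ᵥ y} {v} x∈ y∈)

  𝓜-·ᵥ : ∀ t {u x} → 𝓜 B u s x → 𝓜 B (t ·ᵥ u) s (t ·ᵥ x)
  𝓜-·ᵥ t {u} {x} x∈ = subst (λ z → z ≡ (t ·ᵥ u) [mod s ]) (sym (*ᵥ-·ᵥ B t x)) (≡-mod-· s t {B *ᵥ x} {u} x∈)

  𝓜-negᵥ : ∀ {u x} → 𝓜 B u s x → 𝓜 B (negᵥ u) s (negᵥ x)
  𝓜-negᵥ {u} {x} x∈ = subst₂ (λ v z → 𝓜 B v s z) (sym (negᵥ≡-1·ᵥ u)) (sym (negᵥ≡-1·ᵥ x)) (𝓜-·ᵥ (- 1ℤ) {u} {x} x∈)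

  𝓜--ᵥ : ∀ {u v x y} → 𝓜 B u s x → 𝓜 B v s y → 𝓜 B (u -ᵥ v) s (x -ᵥ y)
  𝓜--ᵥ {u} {v} {x} {y} x∈ y∈ =
    subst₂ (λ v z → 𝓜 B v s z) (sym (-ᵥ≡+ᵥnegᵥ u v)) (sym (-ᵥ≡+ᵥnegᵥ x y)) (𝓜-+ᵥ {u} {negᵥ v} {x} {negᵥ y} x∈ (𝓜-negᵥ {v} {y} y∈))

  𝓜? : ∀ w → Decidable (𝓜 B w s)
  𝓜? w x = Fin.all? λ i → ∣ lookup s i ∣ ℕ.∣? ∣ lookup (B *ᵥ x) i - lookup w i ∣

record IsSubmodule {n : ℕ} (L : Vecℤ n → Set) : Set where
  field
    0ᵥ-closed : L 0ᵥ
    +ᵥ-closed : ∀ {x y} → L x → L y → L (x +ᵥ y)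
    ·ᵥ-closed : ∀ t {x} → L x → L (t ·ᵥ x)

  negᵥ-closed : ∀ {x} → L x → L (negᵥ x)
  negᵥ-closed {x} x∈ = subst L (sym (negᵥ≡-1·ᵥ x)) (·ᵥ-closed (- 1ℤ) x∈)

  ∑ᵥ-closed : ∀ k {v : Fin k → Vecℤ n} → (∀ j → L (v j)) → L (∑ᵥ k v)
  ∑ᵥ-closed zero    v∈ = 0ᵥ-closed
  ∑ᵥ-closed (suc k) v∈ = +ᵥ-closed (v∈ zero) (∑ᵥ-closed k (v∈ ∘ suc))

  *ᵥ-closed : ∀ {U} → (∀ j → L (col U j)) → ∀ c → L (U *ᵥ c)
  *ᵥ-closed {U} cols∈ c = subst L (sym (*ᵥ≡∑ᵥ-columns U c)) (∑ᵥ-closed n (λ j → ·ᵥ-closed (lookup c j) (cols∈ j)))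

record SameCoset {n : ℕ} (L : Vecℤ n → Set) (x y : Vecℤ n) : Set where
  constructor sameCoset
  field difference∈ : L (x -ᵥ y)

module SameCosetProperties {n : ℕ} {L : Vecℤ n → Set} (L-sub : IsSubmodule L) where
  open IsSubmodule L-sub

  sameCoset-sym : ∀ {x y} → SameCoset L x y → SameCoset L y x
  sameCoset-sym {x} {y} (sameCoset x-y∈) = sameCoset (subst L (negᵥ-ᵥ x y) (negᵥ-closed x-y∈))

  sameCoset-trans : ∀ {x y z} → SameCoset L x y → SameCoset L y z → SameCoset L x z
  sameCoset-trans {x} {y} {z} (sameCoset x-y∈) (sameCoset y-z∈) =
    sameCoset (subst L (-ᵥ-telescope x y z) (+ᵥ-closed x-y∈ y-z∈))

  ∈⇒sameCoset-0ᵥ : ∀ {x} → L x → SameCoset L x 0ᵥ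
  ∈⇒sameCoset-0ᵥ {x} x∈ = sameCoset (subst L (sym (-ᵥ-identityʳ x)) x∈)

  sameCoset-0ᵥ⇒∈ : ∀ {x} → SameCoset L x 0ᵥ → L x
  sameCoset-0ᵥ⇒∈ {x} (sameCoset x-0∈) = subst L (-ᵥ-identityʳ x) x-0∈

module _ {n : ℕ} (B : Mat n) (s : Vecℤ n) where

  𝓜-0ᵥ-isSubmodule : IsSubmodule (𝓜 B 0ᵥ s)
  𝓜-0ᵥ-isSubmodule = record
    { 0ᵥ-closed = subst (λ z → z ≡ 0ᵥ [mod s ]) (sym (*ᵥ-0ᵥ B)) (≡-mod-refl s 0ᵥ)
    ; +ᵥ-closed = λ {x} {y} x∈ y∈ →
        subst (λ v → 𝓜 B v s (x +ᵥ y)) (+ᵥ-identityˡ 0ᵥ) (𝓜-+ᵥ B s {0ᵥ} {0ᵥ} {x} {y} x∈ y∈)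
    ; ·ᵥ-closed = λ t {x} x∈ → subst (λ v → 𝓜 B v s (t ·ᵥ x)) (·ᵥ-zeroʳ t) (𝓜-·ᵥ B s t {0ᵥ} {x} x∈)
    }

  𝓜⇒sameCoset : ∀ {u x y} → 𝓜 B u s x → 𝓜 B u s y → SameCoset (𝓜 B 0ᵥ s) x y
  𝓜⇒sameCoset {u} {x} {y} x∈ y∈ = sameCoset (
    subst (λ v → 𝓜 B v s (x -ᵥ y)) (-ᵥ-self u) (𝓜--ᵥ B s {u} {u} {x} {y} x∈ y∈))

  sameCoset⇒𝓜 : ∀ {u x y} → 𝓜 B u s y → SameCoset (𝓜 B 0ᵥ s) x y → 𝓜 B u s x
  sameCoset⇒𝓜 {u} {x} {y} y∈ (sameCoset x-y∈) =
    subst₂ (λ v z → 𝓜 B v s z) (+ᵥ-identityˡ u) (-ᵥ-+ᵥ-cancel x y) (𝓜-+ᵥ B s {0ᵥ} {u} {x -ᵥ y} {y} x-y∈ y∈)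

module _ {n : ℕ} {L : Vecℤ n → Set} (L-sub : IsSubmodule L) (y : Vecℤ n) where
  open IsSubmodule L-sub

  private
    lookup-affine : ∀ t m i → lookup ((t ·ᵥ y) +ᵥ m) i ≡ t * lookup y i + lookup m i
    lookup-affine t m i = trans (lookup-+ᵥ (t ·ᵥ y) m i) (cong (_+ lookup m i) (lookup-·ᵥ t y i))

  ⊕-inj₂ : ∀ {x} → L x → (ℤ· y ⊕ L) x
  ⊕-inj₂ {x} x∈ = 0ℤ , x , x∈ , lookup-ext λ i → sym (trans (lookup-affine 0ℤ x i) (+-identityˡ _))

  ⊕-generator : (ℤ· y ⊕ L) y
  ⊕-generator = 1ℤ , 0ᵥ , 0ᵥ-closed , lookup-ext λ i → sym
    (trans (lookup-affine 1ℤ 0ᵥ i) (trans (cong (_+_ (1ℤ * lookup y i)) (lookup-0ᵥ i))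
      (trans (+-identityʳ _) (*-identityˡ _))))

  ⊕-isSubmodule : IsSubmodule (ℤ· y ⊕ L)
  ⊕-isSubmodule = record
    { 0ᵥ-closed = ⊕-inj₂ 0ᵥ-closed
    ; +ᵥ-closed = λ where
        (t , m , m∈ , refl) (t′ , m′ , m′∈ , refl) →
          t + t′ , m +ᵥ m′ , +ᵥ-closed m∈ m′∈ , lookup-ext λ i → begin
            lookup (((t ·ᵥ y) +ᵥ m) +ᵥ ((t′ ·ᵥ y) +ᵥ m′)) i
              ≡⟨ lookup-+ᵥ ((t ·ᵥ y) +ᵥ m) ((t′ ·ᵥ y) +ᵥ m′) i ⟩
            lookup ((t ·ᵥ y) +ᵥ m) i + lookup ((t′ ·ᵥ y) +ᵥ m′) i
              ≡⟨ cong₂ _+_ (lookup-affine t m i) (lookup-affine t′ m′ i) ⟩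
            (t * lookup y i + lookup m i) + (t′ * lookup y i + lookup m′ i)
              ≡⟨ collect t t′ (lookup y i) (lookup m i) (lookup m′ i) ⟩
            (t + t′) * lookup y i + (lookup m i + lookup m′ i)
              ≡⟨ sym (trans (lookup-affine (t + t′) (m +ᵥ m′) i) (cong (_+_ ((t + t′) * lookup y i)) (lookup-+ᵥ m m′ i))) ⟩
            lookup (((t + t′) ·ᵥ y) +ᵥ (m +ᵥ m′)) i ∎
    ; ·ᵥ-closed = λ where
        c (t , m , m∈ , refl) → c * t , c ·ᵥ m , ·ᵥ-closed c m∈ , lookup-ext λ i → begin
          lookup (c ·ᵥ ((t ·ᵥ y) +ᵥ m)) i
            ≡⟨ trans (lookup-·ᵥ c ((t ·ᵥ y) +ᵥ m) i) (cong (c *_) (lookup-affine t m i)) ⟩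
          c * (t * lookup y i + lookup m i)
            ≡⟨ distribute c t (lookup y i) (lookup m i) ⟩
          c * t * lookup y i + c * lookup m i
            ≡⟨ sym (trans (lookup-affine (c * t) (c ·ᵥ m) i) (cong (_+_ (c * t * lookup y i)) (lookup-·ᵥ c m i))) ⟩
          lookup (((c * t) ·ᵥ y) +ᵥ (c ·ᵥ m)) i ∎
    }
    where
    open ≡-Reasoning
    collect : ∀ t t′ a b c → (t * a + b) + (t′ * a + c) ≡ (t + t′) * a + (b + c)
    collect = solve-∀
    distribute : ∀ c t a b → c * (t * a + b) ≡ c * t * a + c * b
    distribute = solve-∀

  ⊕-sameCoset : ∀ {x z} → SameCoset L x z → (ℤ· y ⊕ L) z → (ℤ· y ⊕ L) x
  ⊕-sameCoset {x} {z} (sameCoset x-z∈) z∈ =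
    subst (ℤ· y ⊕ L) (-ᵥ-+ᵥ-cancel x z) (IsSubmodule.+ᵥ-closed ⊕-isSubmodule (⊕-inj₂ x-z∈) z∈)

  ⊕⊆ : L y → ∀ {x} → (ℤ· y ⊕ L) x → L x
  ⊕⊆ y∈ (t , m , m∈ , refl) = +ᵥ-closed (·ᵥ-closed t y∈) m∈

  -- y − (−y) = 2y ∈ L, so the coset of t y + m only depends on the parity of t
  ⊕-parity : SameCoset L y (negᵥ y) → ∀ {x} → (ℤ· y ⊕ L) x →
             ∃ λ (k : Fin 2) → SameCoset L x ((+ toℕ k) ·ᵥ y)
  ⊕-parity (sameCoset 2y∈) (t , m , m∈ , refl) =
    Fin.fromℕ< (n%ℕd<d t 2) , sameCoset (
    subst L (sym (lookup-ext pointwise)) (+ᵥ-closed (·ᵥ-closed (t /ℕ 2) 2y∈) m∈))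
    where
    r : ℕ
    r = toℕ (Fin.fromℕ< (n%ℕd<d t 2))
    t≡r+q*2 : t ≡ + r + (t /ℕ 2) * + 2
    t≡r+q*2 = trans (a≡a%ℕn+[a/ℕn]*n t 2) (cong (λ k → + k + (t /ℕ 2) * + 2) (sym (Fin.toℕ-fromℕ< _)))
    shift : ∀ r q a b → ((r + q * + 2) * a + b) - r * a ≡ q * (a - - a) + b
    shift = solve-∀
    pointwise : ∀ i → lookup (((t ·ᵥ y) +ᵥ m) -ᵥ ((+ r) ·ᵥ y)) i ≡ lookup (((t /ℕ 2) ·ᵥ (y -ᵥ negᵥ y)) +ᵥ m) i
    pointwise i = begin
      lookup (((t ·ᵥ y) +ᵥ m) -ᵥ ((+ r) ·ᵥ y)) i
        ≡⟨ trans (lookup--ᵥ ((t ·ᵥ y) +ᵥ m) ((+ r) ·ᵥ y) i) (cong₂ _-_ (lookup-affine t m i) (lookup-·ᵥ (+ r) y i)) ⟩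
      (t * lookup y i + lookup m i) - (+ r) * lookup y i
        ≡⟨ cong (λ t → (t * lookup y i + lookup m i) - (+ r) * lookup y i) t≡r+q*2 ⟩
      ((+ r + (t /ℕ 2) * + 2) * lookup y i + lookup m i) - (+ r) * lookup y i
        ≡⟨ shift (+ r) (t /ℕ 2) (lookup y i) (lookup m i) ⟩
      (t /ℕ 2) * (lookup y i - - lookup y i) + lookup m i
        ≡⟨ sym (trans (lookup-+ᵥ ((t /ℕ 2) ·ᵥ (y -ᵥ negᵥ y)) m i) (cong (_+ lookup m i) (trans (lookup-·ᵥ (t /ℕ 2) (y -ᵥ negᵥ y) i)
             (cong ((t /ℕ 2) *_) (trans (lookup--ᵥ y (negᵥ y) i) (cong (_-_ (lookup y i)) (lookup-negᵥ y i))))))) ⟩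
      lookup (((t /ℕ 2) ·ᵥ (y -ᵥ negᵥ y)) +ᵥ m) i ∎
      where open ≡-Reasoning

injective⇒surjective : ∀ {d} {c : Fin d → Fin d} → Injective _≡_ _≡_ c → ∀ k → ∃ λ i → c i ≡ k
injective⇒surjective {suc d} {c} c-injective k with Fin.any? (λ i → c i Fin.≟ k)
... | yes hit  = hit
... | no  miss = contradiction (Fin.injective⇒≤ punched-injective) ℕ.1+n≰n
  where
  k≢c : ∀ i → k ≢ c i
  k≢c i k≡ci = miss (i , sym k≡ci)
  punched : Fin (suc d) → Fin d
  punched i = punchOut (k≢c i)
  punched-injective : Injective _≡_ _≡_ punched
  punched-injective {i} {j} eq = c-injective (Fin.punchOut-injective (k≢c i) (k≢c j) eq)

module _ {n : ℕ} {L : Vecℤ n → Set} (L-sub : IsSubmodule L) {T : Vecℤ n → Set} where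
  open SameCosetProperties L-sub

  index-≤ : ∀ {d m} → HasIndex T L d → (h : Fin m → Vecℤ n) →
            (∀ {x} → T x → ∃ λ k → SameCoset L x (h k)) → d ℕ.≤ m
  index-≤ {d} {m} (f , f∈T , f-distinct , _) h cover = Fin.injective⇒≤ k-injective
    where
    k : Fin d → Fin m
    k i = proj₁ (cover (f∈T i))
    k-injective : Injective _≡_ _≡_ k
    k-injective {i} {j} ki≡kj = f-distinct i j (SameCoset.difference∈ (sameCoset-trans (proj₂ (cover (f∈T i)))
      (subst (λ k → SameCoset L (h k) (f j)) (sym ki≡kj) (sameCoset-sym (proj₂ (cover (f∈T j)))))))

  index-cover : ∀ {d} → HasIndex T L d → (g : Fin d → Vecℤ n) → (∀ i → T (g i)) →
                (∀ i j → SameCoset L (g i) (g j) → i ≡ j) →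
                ∀ {x} → T x → ∃ λ i → SameCoset L x (g i)
  index-cover {d} (f , _ , _ , f-cover) g g∈T g-distinct {x} x∈T = i , x∼gi
    where
    coset : ∀ {z} → T z → ∃ λ k → SameCoset L z (f k)
    coset {z} z∈T = let (k , z-fk∈) = f-cover z z∈T in k , sameCoset z-fk∈
    c : Fin d → Fin d
    c i = proj₁ (coset (g∈T i))
    c-injective : Injective _≡_ _≡_ c
    c-injective {i} {j} ci≡cj = g-distinct i j (sameCoset-trans (proj₂ (coset (g∈T i)))
      (subst (λ k → SameCoset L (f k) (g j)) (sym ci≡cj) (sameCoset-sym (proj₂ (coset (g∈T j))))))
    k : Fin d
    k = proj₁ (coset x∈T)
    i : Fin d
    i = proj₁ (injective⇒surjective c-injective k)
    x∼gi : SameCoset L x (g i)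
    x∼gi = sameCoset-trans (proj₂ (coset x∈T))
      (subst (λ k → SameCoset L (f k) (g i)) (proj₂ (injective⇒surjective c-injective k))
        (sameCoset-sym (proj₂ (coset (g∈T i)))))

module _ {n : ℕ} (M : Mat n) where

  Q-0ᵥ : Q M 0ᵥ ≡ 0ℤ
  Q-0ᵥ = trans (∑-cong n (λ i → trans (∑-cong n (λ j → vanish i j)) (∑-zero n))) (∑-zero n)
    where
    vanish : ∀ i j → lookup (0ᵥ {n}) i * M i j * lookup (0ᵥ {n}) j ≡ 0ℤ
    vanish i j = trans (cong (lookup (0ᵥ {n}) i * M i j *_) (lookup-0ᵥ j)) (*-zeroʳ (lookup (0ᵥ {n}) i * M i j))

  Q-·ᵥ : ∀ c x → Q M (c ·ᵥ x) ≡ c * c * Q M x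
  Q-·ᵥ c x = begin
    Q M (c ·ᵥ x)
      ≡⟨ ∑-cong n (λ i → ∑-cong n (λ j → term i j)) ⟩
    ∑ n (λ i → ∑ n (λ j → c * c * (lookup x i * M i j * lookup x j)))
      ≡⟨ ∑-cong n (λ i → *-distribˡ-∑ n (c * c) _) ⟩
    ∑ n (λ i → c * c * ∑ n (λ j → lookup x i * M i j * lookup x j))
      ≡⟨ *-distribˡ-∑ n (c * c) _ ⟩
    c * c * Q M x ∎
    where
    open ≡-Reasoning
    pull : ∀ c a m b → c * a * m * (c * b) ≡ c * c * (a * m * b)
    pull = solve-∀
    term : ∀ i j → lookup (c ·ᵥ x) i * M i j * lookup (c ·ᵥ x) j ≡ c * c * (lookup x i * M i j * lookup x j)
    term i j = trans (cong₂ (λ u v → u * M i j * v) (lookup-·ᵥ c x i) (lookup-·ᵥ c x j))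
                     (pull c (lookup x i) (M i j) (lookup x j))

  Q-negᵥ : ∀ x → Q M (negᵥ x) ≡ Q M x
  Q-negᵥ x = trans (cong (Q M) (negᵥ≡-1·ᵥ x)) (trans (Q-·ᵥ (- 1ℤ) x) (*-identityˡ (Q M x)))

  Q-∣ : ∀ {g} x → (∀ i → g ∣ lookup x i) → g ∣ Q M x
  Q-∣ x g∣x = ∑-∣ n _ (λ i → ∑-∣ n _ (λ j → ∣m⇒∣m*n (lookup x j) (∣m⇒∣m*n (M i j) (g∣x i))))

  Q-congr : ∀ U c → Q (congr M U) c ≡ Q M (U *ᵥ c)
  Q-congr U c = begin
    Q (congr M U) c
      ≡⟨ ∑-cong n (λ k → ∑-cong n (λ l → *-∑∑-* (lookup c k) (lookup c l) _)) ⟩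
    ∑ n (λ k → ∑ n (λ l → ∑ n (λ i → ∑ n (λ j → F k l i j))))
      ≡⟨ ∑-cong n (λ k → ∑-comm n n _) ⟩
    ∑ n (λ k → ∑ n (λ i → ∑ n (λ l → ∑ n (λ j → F k l i j))))
      ≡⟨ ∑-comm n n _ ⟩
    ∑ n (λ i → ∑ n (λ k → ∑ n (λ l → ∑ n (λ j → F k l i j))))
      ≡⟨ ∑-cong n (λ i → ∑-cong n (λ k → ∑-comm n n _)) ⟩
    ∑ n (λ i → ∑ n (λ k → ∑ n (λ j → ∑ n (λ l → F k l i j))))
      ≡⟨ ∑-cong n (λ i → ∑-comm n n _) ⟩
    ∑ n (λ i → ∑ n (λ j → ∑ n (λ k → ∑ n (λ l → F k l i j))))
      ≡⟨ ∑-cong n (λ i → ∑-cong n (λ j → ∑-cong n (λ k → ∑-cong n (λ l →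
           regroup (lookup c k) (U i k) (M i j) (U j l) (lookup c l))))) ⟩
    ∑ n (λ i → ∑ n (λ j → ∑ n (λ k → ∑ n (λ l → U i k * lookup c k * M i j * (U j l * lookup c l)))))
      ≡⟨ ∑-cong n (λ i → ∑-cong n (λ j → sym (∑-*-*-∑ (M i j)))) ⟩
    ∑ n (λ i → ∑ n (λ j → ∑ n (λ k → U i k * lookup c k) * M i j * ∑ n (λ l → U j l * lookup c l)))
      ≡⟨ ∑-cong n (λ i → ∑-cong n (λ j →
           sym (cong₂ (λ a b → a * M i j * b) (lookup-*ᵥ U c i) (lookup-*ᵥ U c j)))) ⟩
    Q M (U *ᵥ c) ∎
    where
    open ≡-Reasoning
    F : Fin n → Fin n → Fin n → Fin n → ℤ
    F k l i j = lookup c k * (U i k * M i j * U j l) * lookup c l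
    regroup : ∀ ck uik mij ujl cl → ck * (uik * mij * ujl) * cl ≡ uik * ck * mij * (ujl * cl)
    regroup = solve-∀
    *-∑∑-* : ∀ a b (f : Fin n → Fin n → ℤ) →
             a * ∑ n (λ i → ∑ n (f i)) * b ≡ ∑ n (λ i → ∑ n (λ j → a * f i j * b))
    *-∑∑-* a b f = trans (cong (_* b) (sym (*-distribˡ-∑ n a _))) (trans (sym (*-distribʳ-∑ n b _))
      (∑-cong n (λ i → trans (cong (_* b) (sym (*-distribˡ-∑ n a _))) (sym (*-distribʳ-∑ n b _)))))
    ∑-*-*-∑ : ∀ {f g : Fin n → ℤ} m → ∑ n f * m * ∑ n g ≡ ∑ n (λ k → ∑ n (λ l → f k * m * g l))
    ∑-*-*-∑ {f} {g} m = trans (cong (_* ∑ n g) (sym (*-distribʳ-∑ n m f)))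
      (∑-*-∑ n n (λ k → f k * m) g)

  congr-symmetric : Symmetric M → ∀ U → Symmetric (congr M U)
  congr-symmetric M-sym U i j = trans (∑-comm n n _) (∑-cong n (λ l → ∑-cong n (λ k →
    trans (cong (λ m → U k i * m * U l j) (M-sym k l)) (reverse (U k i) (M l k) (U l j)))))
    where
    reverse : ∀ a b c → a * b * c ≡ c * b * a
    reverse = solve-∀

  congr-posDef : PosDef M → ∀ U → Injective _≡_ _≡_ (U *ᵥ_) → PosDef (congr M U)
  congr-posDef M-pd U U-injective c c≢0 =
    subst (0ℤ <_) (sym (Q-congr U c)) (M-pd (U *ᵥ c) (λ Uc≡0 → c≢0 (U-injective (trans Uc≡0 (sym (*ᵥ-0ᵥ U))))))

-- Finiteness of the representations by a positive definite form

ListCover : ∀ {n} → (Vecℤ n → Set) → Set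
ListCover {n} P = Σ (List (Vecℤ n)) λ xs → ∀ x → P x → x ∈ xs

absAtMost : ℕ → List ℤ
absAtMost zero    = 0ℤ ∷ []
absAtMost (suc K) = + suc K ∷ -[1+ K ] ∷ absAtMost K

∈-absAtMost : ∀ K z → ∣ z ∣ ℕ.≤ K → z ∈ absAtMost K
∈-absAtMost zero    (+ zero) _ = here refl
∈-absAtMost (suc K) z ∣z∣≤1+K with ℕ.m≤n⇒m<n∨m≡n ∣z∣≤1+K
... | inj₁ ∣z∣<1+K = there (there (∈-absAtMost K z (ℕ.≤-pred ∣z∣<1+K)))
∈-absAtMost (suc K) (+ suc _)  _ | inj₂ refl = here refl
∈-absAtMost (suc K) -[1+ _ ] _ | inj₂ refl = there (here refl)

private
  i*i≥0 : ∀ i → 0ℤ ≤ i * i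
  i*i≥0 i = subst (0ℤ ≤_) (sym (abs-sq i)) (+≤+ ℕ.z≤n)
    where
    abs-sq : ∀ i → i * i ≡ + (∣ i ∣ ℕ.* ∣ i ∣)
    abs-sq (+ zero)  = refl
    abs-sq (+ suc _) = refl
    abs-sq -[1+ _ ]  = refl

  ∣i∣≤∣i*i∣ : ∀ i → ∣ i ∣ ℕ.≤ ∣ i * i ∣
  ∣i∣≤∣i*i∣ (+ zero) = ℕ.z≤n
  ∣i∣≤∣i*i∣ i@(+ suc _) = subst (∣ i ∣ ℕ.≤_) (sym (abs-* i i)) (ℕ.m≤m*n ∣ i ∣ ∣ i ∣)
  ∣i∣≤∣i*i∣ i@(-[1+ _ ]) = subst (∣ i ∣ ℕ.≤_) (sym (abs-* i i)) (ℕ.m≤m*n ∣ i ∣ ∣ i ∣)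

  ∣-∣-mono-≤ : ∀ {i j} → 0ℤ ≤ i → i ≤ j → ∣ i ∣ ℕ.≤ ∣ j ∣
  ∣-∣-mono-≤ (+≤+ _) (+≤+ i≤j) = i≤j

  0<a*q⇒0<q : ∀ {a q} → 0ℤ < a → 0ℤ < a * q → 0ℤ < q
  0<a*q⇒0<q {+ suc k} {q} _ 0<aq =
    *-cancelˡ-<-nonNeg (+ suc k) (subst (_< + suc k * q) (sym (*-zeroʳ (+ suc k))) 0<aq)
  0<a*q⇒0<q {+ zero} (+<+ ())

  a*-mono-≤ : ∀ {a u v} → 0ℤ < a → u ≤ v → a * u ≤ a * v
  a*-mono-≤ {+ suc k} _ = *-monoˡ-≤-nonNeg (+ suc k)
  a*-mono-≤ {+ zero} (+<+ ())

  0<a*q : ∀ {a q} → 0ℤ < a → 0ℤ < q → 0ℤ < a * q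
  0<a*q {+ suc _} {+ suc _} _ _ = +<+ (ℕ.s≤s ℕ.z≤n)
  0<a*q {+ zero} (+<+ ())
  0<a*q {+ suc _} {+ zero} _ (+<+ ())

  ∣i∣≤∣a*i∣ : ∀ {a} i → 0ℤ < a → ∣ i ∣ ℕ.≤ ∣ a * i ∣
  ∣i∣≤∣a*i∣ {+ suc k} i _ = subst (∣ i ∣ ℕ.≤_) (sym (abs-* (+ suc k) i)) (ℕ.m≤n*m ∣ i ∣ (suc k))
  ∣i∣≤∣a*i∣ {+ zero} _ (+<+ ())

Q-nonNeg : ∀ {n} (M : Mat n) → PosDef M → ∀ x → 0ℤ ≤ Q M x
Q-nonNeg M M-pd x with Vec.≡-dec _≟_ x 0ᵥ
... | yes refl = ≤-reflexive (sym (Q-0ᵥ M))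
... | no  x≢0  = <⇒≤ (M-pd x x≢0)

module Schur {n : ℕ} (M : Mat (suc n)) (M-sym : Symmetric M) where

  a : ℤ
  a = M zero zero

  m : Fin n → ℤ
  m j = M zero (suc j)

  M′ : Mat n
  M′ i j = M (suc i) (suc j)

  lin : Vecℤ n → ℤ
  lin x = ∑ n (λ j → m j * lookup x j)

  S : Mat n
  S i j = a * M′ i j - m i * m j

  S-symmetric : Symmetric S
  S-symmetric i j = cong₂ (λ u v → a * u - v) (M-sym (suc i) (suc j)) (*-comm (m i) (m j))

  lin-·ᵥ : ∀ c x → lin (c ·ᵥ x) ≡ c * lin x
  lin-·ᵥ c x = trans (∑-cong n (λ j → trans (cong (m j *_) (lookup-·ᵥ c x j)) (swap (m j) c (lookup x j))))
                     (*-distribˡ-∑ n c _)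
    where
    swap : ∀ a b c → a * (b * c) ≡ b * (a * c)
    swap = solve-∀

  lin-0ᵥ : lin 0ᵥ ≡ 0ℤ
  lin-0ᵥ = trans (∑-cong n (λ j → trans (cong (m j *_) (lookup-0ᵥ j)) (*-zeroʳ (m j)))) (∑-zero n)

  Q-∷ : ∀ x₀ x → Q M (x₀ ∷ x) ≡ x₀ * a * x₀ + x₀ * lin x + lin x * x₀ + Q M′ x
  Q-∷ x₀ x = begin
    Q M (x₀ ∷ x)
      ≡⟨⟩
    (x₀ * a * x₀ + ∑ n (λ j → x₀ * m j * lookup x j))
      + ∑ n (λ i → lookup x i * M (suc i) zero * x₀ + ∑ n (λ j → lookup x i * M′ i j * lookup x j))
      ≡⟨ cong₂ (λ u v → (x₀ * a * x₀ + u) + v) first-row (∑-distrib-+ n _ _) ⟩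
    (x₀ * a * x₀ + x₀ * lin x) + (∑ n (λ i → lookup x i * M (suc i) zero * x₀) + Q M′ x)
      ≡⟨ cong (λ u → (x₀ * a * x₀ + x₀ * lin x) + (u + Q M′ x)) first-column ⟩
    (x₀ * a * x₀ + x₀ * lin x) + (lin x * x₀ + Q M′ x)
      ≡⟨ reassoc (x₀ * a * x₀) (x₀ * lin x) (lin x * x₀) (Q M′ x) ⟩
    x₀ * a * x₀ + x₀ * lin x + lin x * x₀ + Q M′ x ∎
    where
    open ≡-Reasoning
    reassoc : ∀ p q r s → (p + q) + (r + s) ≡ p + q + r + s
    reassoc = solve-∀
    first-row : ∑ n (λ j → x₀ * m j * lookup x j) ≡ x₀ * lin x
    first-row = trans (∑-cong n (λ j → *-assoc x₀ (m j) (lookup x j))) (*-distribˡ-∑ n x₀ _)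
    first-column : ∑ n (λ i → lookup x i * M (suc i) zero * x₀) ≡ lin x * x₀
    first-column = trans (∑-cong n (λ i → cong (_* x₀)
        (trans (cong (lookup x i *_) (M-sym (suc i) zero)) (*-comm (lookup x i) (m i)))))
      (*-distribʳ-∑ n x₀ _)

  Q-S : ∀ x → Q S x ≡ a * Q M′ x - lin x * lin x
  Q-S x = begin
    Q S x
      ≡⟨ ∑-cong n (λ i → ∑-cong n (λ j → expand (lookup x i) a (M′ i j) (m i) (m j) (lookup x j))) ⟩
    ∑ n (λ i → ∑ n (λ j → a * (lookup x i * M′ i j * lookup x j) + - (m i * lookup x i * (m j * lookup x j))))
      ≡⟨ ∑-cong n (λ i → trans (∑-distrib-+ n _ _) (cong₂ _+_ (*-distribˡ-∑ n a _) (neg-distrib-∑ n _))) ⟩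
    ∑ n (λ i → a * ∑ n (λ j → lookup x i * M′ i j * lookup x j) + - ∑ n (λ j → m i * lookup x i * (m j * lookup x j)))
      ≡⟨ trans (∑-distrib-+ n _ _) (cong₂ _+_ (*-distribˡ-∑ n a _) (neg-distrib-∑ n _)) ⟩
    a * Q M′ x - ∑ n (λ i → ∑ n (λ j → m i * lookup x i * (m j * lookup x j)))
      ≡⟨ cong (λ u → a * Q M′ x - u) (sym (∑-*-∑ n n _ _)) ⟩
    a * Q M′ x - lin x * lin x ∎
    where
    open ≡-Reasoning
    expand : ∀ xi a mij mi mj xj → xi * (a * mij - mi * mj) * xj ≡ a * (xi * mij * xj) + - (mi * xi * (mj * xj))
    expand = solve-∀

  a*Q≡square+Q-S : ∀ x₀ x → a * Q M (x₀ ∷ x) ≡ (a * x₀ + lin x) * (a * x₀ + lin x) + Q S x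
  a*Q≡square+Q-S x₀ x =
    trans (cong (a *_) (Q-∷ x₀ x))
      (trans (complete-square a x₀ (lin x) (Q M′ x)) (cong (_+_ ((a * x₀ + lin x) * (a * x₀ + lin x))) (sym (Q-S x))))
    where
    complete-square : ∀ a x₀ l q → a * (x₀ * a * x₀ + x₀ * l + l * x₀ + q) ≡ (a * x₀ + l) * (a * x₀ + l) + (a * q - l * l)
    complete-square = solve-∀

module SchurPosDef {n : ℕ} (M : Mat (suc n)) (M-sym : Symmetric M) (M-pd : PosDef M) where
  open Schur M M-sym

  0<a : 0ℤ < a
  0<a = subst (0ℤ <_) Q[e₀]≡a (M-pd (1ℤ ∷ 0ᵥ) (λ e₀≡0 → 1≢0 (Vec.∷-injectiveˡ e₀≡0)))
    where
    1≢0 : 1ℤ ≢ 0ℤ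
    1≢0 ()
    simplify : ∀ a l q → 1ℤ * a * 1ℤ + 1ℤ * l + l * 1ℤ + q ≡ a + (l + l) + q
    simplify = solve-∀
    Q[e₀]≡a : Q M (1ℤ ∷ 0ᵥ) ≡ a
    Q[e₀]≡a = trans (Q-∷ 1ℤ 0ᵥ) (trans (simplify a (lin 0ᵥ) (Q M′ 0ᵥ))
      (trans (cong₂ (λ u v → a + (u + u) + v) lin-0ᵥ (Q-0ᵥ M′)) (trans (+-identityʳ _) (+-identityʳ a))))

  -- test M on (−lin x, a x), which kills the square in a*Q≡square+Q-S
  S-posDef : PosDef S
  S-posDef x x≢0 = 0<a*q⇒0<q 0<a (0<a*q⇒0<q 0<a (subst (0ℤ <_) a*Q[z]≡a*a*Q[x] (0<a*q 0<a (M-pd z z≢0))))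
    where
    z : Vecℤ (suc n)
    z = (- lin x) ∷ (a ·ᵥ x)
    z≢0 : z ≢ 0ᵥ
    z≢0 z≡0 = x≢0 (lookup-ext x≡0)
      where
      x≡0 : ∀ i → lookup x i ≡ lookup (0ᵥ {n}) i
      x≡0 i with i*j≡0⇒i≡0∨j≡0 a (trans (sym (lookup-·ᵥ a x i)) (trans (cong (λ v → lookup v i) (Vec.∷-injectiveʳ z≡0)) (lookup-0ᵥ i)))
      ... | inj₁ a≡0 = contradiction (subst (0ℤ <_) a≡0 0<a) (<-irrefl refl)
      ... | inj₂ xᵢ≡0 = trans xᵢ≡0 (sym (lookup-0ᵥ i))
    cancel : ∀ a l q → (a * (- l) + a * l) * (a * (- l) + a * l) + a * a * q ≡ a * (a * q)
    cancel = solve-∀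
    a*Q[z]≡a*a*Q[x] : a * Q M z ≡ a * (a * Q S x)
    a*Q[z]≡a*a*Q[x] = trans (a*Q≡square+Q-S (- lin x) (a ·ᵥ x))
      (trans (cong₂ (λ u v → (a * (- lin x) + u) * (a * (- lin x) + u) + v) (lin-·ᵥ a x) (Q-·ᵥ S a x))
        (cancel a (lin x) (Q S x)))

Q≤-cover : ∀ n (M : Mat n) → Symmetric M → PosDef M → ∀ b → ListCover (λ x → Q M x ≤ b)
Q≤-cover zero    M _     _    b = [] ∷ [] , λ { [] _ → here refl }
Q≤-cover (suc n) M M-sym M-pd b = concatMap candidates (proj₁ S-cover) , covers
  where
  open Schur M M-sym
  open SchurPosDef M M-sym M-pd
  S-cover : ListCover (λ x → Q S x ≤ a * b)
  S-cover = Q≤-cover n S S-symmetric S-posDef (a * b)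
  candidates : Vecℤ n → List (Vecℤ (suc n))
  candidates x = List.map (_∷ x) (absAtMost (∣ a * b ∣ ℕ.+ ∣ lin x ∣))
  covers : ∀ x → Q M x ≤ b → x ∈ concatMap candidates (proj₁ S-cover)
  covers (x₀ ∷ x) Q≤b = ∈-concatMap⁺ candidates (lose (proj₂ S-cover x Q-S≤ab) (∈-map⁺ (_∷ x) (∈-absAtMost _ x₀ ∣x₀∣≤)))
    where
    y : ℤ
    y = a * x₀ + lin x
    aQ≤ab : a * Q M (x₀ ∷ x) ≤ a * b
    aQ≤ab = a*-mono-≤ 0<a Q≤b
    Q-S≤ab : Q S x ≤ a * b
    Q-S≤ab = ≤-trans (≤-trans (≤-reflexive (sym (+-identityˡ (Q S x)))) (+-monoˡ-≤ (Q S x) (i*i≥0 y)))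
      (≤-trans (≤-reflexive (sym (a*Q≡square+Q-S x₀ x))) aQ≤ab)
    y²≤ab : y * y ≤ a * b
    y²≤ab = ≤-trans (≤-trans (≤-reflexive (sym (+-identityʳ (y * y)))) (+-monoʳ-≤ (y * y) (Q-nonNeg S S-posDef x)))
      (≤-trans (≤-reflexive (sym (a*Q≡square+Q-S x₀ x))) aQ≤ab)
    shift : ∀ a x₀ l → a * x₀ ≡ (a * x₀ + l) - l
    shift = solve-∀
    ∣x₀∣≤ : ∣ x₀ ∣ ℕ.≤ ∣ a * b ∣ ℕ.+ ∣ lin x ∣
    ∣x₀∣≤ = ℕ.≤-trans (∣i∣≤∣a*i∣ x₀ 0<a) (ℕ.≤-trans (ℕ.≤-reflexive (cong ∣_∣ (shift a x₀ (lin x))))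
      (ℕ.≤-trans (∣i-j∣≤∣i∣+∣j∣ y (lin x)) (ℕ.+-monoˡ-≤ ∣ lin x ∣
        (ℕ.≤-trans (∣i∣≤∣i*i∣ y) (∣-∣-mono-≤ (i*i≥0 y) y²≤ab)))))

module _ {n : ℕ} where

  card-unique : ∀ {P : Vecℤ n → Set} {k k′} → HasCard P k → HasCard P k′ → k ≡ k′
  card-unique (xs , xs-unique , refl , xs≈P) (ys , ys-unique , refl , ys≈P) =
    ↭-length (∼bag⇒↭ (unique∧set⇒bag xs-unique ys-unique λ {x} →
      mk⇔ (Equivalence.from (ys≈P x) ∘ Equivalence.to (xs≈P x)) (Equivalence.from (xs≈P x) ∘ Equivalence.to (ys≈P x))))

  card-resp : ∀ {P P′ : Vecℤ n → Set} {k} → (∀ {x} → P x → P′ x) → (∀ {x} → P′ x → P x) →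
              HasCard P k → HasCard P′ k
  card-resp P⊆P′ P′⊆P (xs , xs-unique , len , xs≈P) =
    xs , xs-unique , len , λ x → mk⇔ (P⊆P′ ∘ Equivalence.to (xs≈P x)) (Equivalence.from (xs≈P x) ∘ P′⊆P)

  card-exists : ∀ {P : Vecℤ n → Set} → Decidable P → ListCover P → ∃ (HasCard P)
  card-exists P? (xs , covers) =
    length ys , ys , deduplicate-! (Vec.≡-dec _≟_) (filter P? xs) , refl , λ x →
      mk⇔ (proj₂ ∘ ∈-filter⁻ P? {xs = xs} ∘ ∈-deduplicate⁻ (Vec.≡-dec _≟_) (filter P? xs))
          (λ Px → ∈-deduplicate⁺ (Vec.≡-dec _≟_) (∈-filter⁺ P? {xs = xs} (covers x Px) Px))
    where
    ys = deduplicate (Vec.≡-dec _≟_) (filter P? xs)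

  card-split : ∀ {P D : Vecℤ n → Set} {k} → Decidable D → HasCard P k →
               ∃₂ λ k₁ k₂ → HasCard (λ x → P x × D x) k₁ × HasCard (λ x → P x × ¬ D x) k₂ × k₁ ℕ.+ k₂ ≡ k
  card-split {P} {D} D? (xs , xs-unique , refl , xs≈P) =
    _ , _ , restrict D? , restrict (¬? ∘ D?) , length-filter-∁ xs
    where
    restrict : ∀ {E : Vecℤ n → Set} (E? : Decidable E) → HasCard (λ x → P x × E x) (length (filter E? xs))
    restrict E? = filter E? xs , Unique.filter⁺ E? xs-unique , refl , λ x →
      mk⇔ (λ x∈ → let (x∈xs , Ex) = ∈-filter⁻ E? x∈ in Equivalence.to (xs≈P x) x∈xs , Ex)
          (λ (Px , Ex) → ∈-filter⁺ E? (Equivalence.from (xs≈P x) Px) Ex)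
    length-filter-∁ : ∀ ys → length (filter D? ys) ℕ.+ length (filter (¬? ∘ D?) ys) ≡ length ys
    length-filter-∁ [] = refl
    length-filter-∁ (y ∷ ys) with D? y
    ... | yes _ = cong suc (length-filter-∁ ys)
    ... | no  _ = trans (ℕ.+-suc _ _) (cong suc (length-filter-∁ ys))

  card-image : ∀ {P P′ : Vecℤ n → Set} (f : Vecℤ n → Vecℤ n) → Injective _≡_ _≡_ f →
               (∀ {x} → P x → P′ (f x)) → (∀ {z} → P′ z → ∃ λ x → P x × f x ≡ z) →
               ∀ {k} → HasCard P k → HasCard P′ k
  card-image {P′ = P′} f f-injective f[P]⊆P′ P′⊆f[P] (xs , xs-unique , len , xs≈P) =
    List.map f xs , Unique.map⁺ f-injective xs-unique , trans (List.length-map f xs) len , λ z →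
      mk⇔ (λ z∈ → let (x , x∈xs , z≡fx) = ∈-map⁻ f z∈ in subst P′ (sym z≡fx) (f[P]⊆P′ (Equivalence.to (xs≈P x) x∈xs)))
          (λ P′z → let (x , Px , fx≡z) = P′⊆f[P] P′z in subst (_∈ List.map f xs) fx≡z (∈-map⁺ f (Equivalence.from (xs≈P x) Px)))

-- Determinants and Cramer's rule

minor : ∀ {n} → Mat (suc n) → Fin (suc n) → Mat n
minor A j k l = A (suc k) (punchIn j l)

cofactorTerm : ∀ {n} → Mat (suc n) → Fin (suc n) → ℤ
cofactorTerm {n} A j = sgn j * A zero j * det n (minor A j)

det-cong : ∀ n {A A′ : Mat n} → (∀ r c → A r c ≡ A′ r c) → det n A ≡ det n A′
det-cong zero    A≡A′ = refl
det-cong (suc n) A≡A′ = ∑-cong (suc n) λ j →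
  cong₂ (λ a d → sgn j * a * d) (A≡A′ zero j) (det-cong n (λ k l → A≡A′ (suc k) (punchIn j l)))

punchIn≢ : ∀ {n} {i j : Fin (suc n)} (i≢j : i ≢ j) l → l ≢ punchOut i≢j → punchIn i l ≢ j
punchIn≢ {i = i} i≢j l l≢ pᵢl≡j =
  l≢ (Fin.punchIn-injective i l (punchOut i≢j) (trans pᵢl≡j (sym (Fin.punchIn-punchOut i≢j))))

det-column-∣ : ∀ n (A : Mat n) {g} j → (∀ r → g ∣ A r j) → g ∣ det n A
det-column-∣ (suc n) A {g} j g∣col = ∑-∣ (suc n) (cofactorTerm A) term-∣
  where
  term-∣ : ∀ j′ → g ∣ cofactorTerm A j′
  term-∣ j′ with j′ Fin.≟ j
  ... | yes refl = ∣m⇒∣m*n (det n (minor A j′)) (∣n⇒∣m*n (sgn j′) (g∣col zero))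
  ... | no  j′≢j = ∣n⇒∣m*n (sgn j′ * A zero j′) (det-column-∣ n (minor A j′) (punchOut j′≢j)
        (λ r → subst (λ c → g ∣ A (suc r) c) (sym (Fin.punchIn-punchOut j′≢j)) (g∣col (suc r))))

det-additive-column : ∀ n (A A₁ A₂ : Mat n) j →
  (∀ r c → c ≢ j → A r c ≡ A₁ r c × A r c ≡ A₂ r c) →
  (∀ r → A r j ≡ A₁ r j + A₂ r j) → det n A ≡ det n A₁ + det n A₂
det-additive-column (suc n) A A₁ A₂ j off on =
  trans (∑-cong (suc n) term) (∑-distrib-+ (suc n) (cofactorTerm A₁) (cofactorTerm A₂))
  where
  distrib : ∀ s a b d → s * (a + b) * d ≡ s * a * d + s * b * d
  distrib = solve-∀
  term : ∀ j′ → cofactorTerm A j′ ≡ cofactorTerm A₁ j′ + cofactorTerm A₂ j′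
  term j′ with j′ Fin.≟ j
  ... | yes refl =
    trans (cong (λ a → sgn j′ * a * det n (minor A j′)) (on zero))
      (trans (distrib (sgn j′) (A₁ zero j′) (A₂ zero j′) (det n (minor A j′)))
        (cong₂ (λ d₁ d₂ → sgn j′ * A₁ zero j′ * d₁ + sgn j′ * A₂ zero j′ * d₂)
          (det-cong n (λ k l → proj₁ (off (suc k) (punchIn j′ l) (Fin.punchInᵢ≢i j′ l))))
          (det-cong n (λ k l → proj₂ (off (suc k) (punchIn j′ l) (Fin.punchInᵢ≢i j′ l))))))
  ... | no j′≢j =
    trans (cong (λ d → sgn j′ * A zero j′ * d)
        (det-additive-column n (minor A j′) (minor A₁ j′) (minor A₂ j′) (punchOut j′≢j)
          (λ r l l≢ → off (suc r) (punchIn j′ l) (punchIn≢ j′≢j l l≢))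
          (λ r → subst (λ c → A (suc r) c ≡ A₁ (suc r) c + A₂ (suc r) c) (sym (Fin.punchIn-punchOut j′≢j)) (on (suc r)))))
      (trans (*-distribˡ-+ (sgn j′ * A zero j′) _ _)
        (cong₂ (λ a₁ a₂ → sgn j′ * a₁ * det n (minor A₁ j′) + sgn j′ * a₂ * det n (minor A₂ j′))
          (proj₁ (off zero j′ j′≢j)) (proj₂ (off zero j′ j′≢j))))

det-scale-column : ∀ n (A A₁ : Mat n) j t → (∀ r c → c ≢ j → A r c ≡ A₁ r c) →
  (∀ r → A r j ≡ t * A₁ r j) → det n A ≡ t * det n A₁
det-scale-column (suc n) A A₁ j t off on =
  trans (∑-cong (suc n) term) (*-distribˡ-∑ (suc n) t (cofactorTerm A₁))
  where
  pull-row : ∀ s a t d → s * (t * a) * d ≡ t * (s * a * d)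
  pull-row = solve-∀
  pull-minor : ∀ s a t d → s * a * (t * d) ≡ t * (s * a * d)
  pull-minor = solve-∀
  term : ∀ j′ → cofactorTerm A j′ ≡ t * cofactorTerm A₁ j′
  term j′ with j′ Fin.≟ j
  ... | yes refl =
    trans (cong₂ (λ a d → sgn j′ * a * d) (on zero)
        (det-cong n (λ k l → off (suc k) (punchIn j′ l) (Fin.punchInᵢ≢i j′ l))))
      (pull-row (sgn j′) (A₁ zero j′) t (det n (minor A₁ j′)))
  ... | no j′≢j =
    trans (cong₂ (λ a d → sgn j′ * a * d) (off zero j′ j′≢j)
        (det-scale-column n (minor A j′) (minor A₁ j′) (punchOut j′≢j) t
          (λ r l l≢ → off (suc r) (punchIn j′ l) (punchIn≢ j′≢j l l≢))
          (λ r → subst (λ c → A (suc r) c ≡ t * A₁ (suc r) c) (sym (Fin.punchIn-punchOut j′≢j)) (on (suc r)))))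
      (pull-minor (sgn j′) (A₁ zero j′) t (det n (minor A₁ j′)))

sgn-suc : ∀ {n} (i : Fin n) → sgn (suc i) ≡ - sgn i
sgn-suc zero    = refl
sgn-suc (suc i) = trans (sym (neg-involutive _)) (cong -_ (sym (sgn-suc i)))

sgn-inject₁ : ∀ {n} (i : Fin n) → sgn (inject₁ i) ≡ sgn i
sgn-inject₁ zero          = refl
sgn-inject₁ (suc zero)    = refl
sgn-inject₁ (suc (suc i)) = sgn-inject₁ i

-- the transposition of inject₁ c and suc c
adjSwap : ∀ {n} → Fin n → Fin (suc n) → Fin (suc n)
adjSwap zero    zero          = suc zero
adjSwap zero    (suc zero)    = zero
adjSwap zero    (suc (suc x)) = suc (suc x)
adjSwap (suc c) zero          = zero
adjSwap (suc c) (suc x)       = suc (adjSwap c x)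

∑-adjSwap : ∀ n (c : Fin n) (f : Fin (suc n) → ℤ) → ∑ (suc n) (f ∘ adjSwap c) ≡ ∑ (suc n) f
∑-adjSwap (suc n) zero    f = swap (f (suc zero)) (f zero) _
  where
  swap : ∀ a b c → a + (b + c) ≡ b + (a + c)
  swap = solve-∀
∑-adjSwap (suc n) (suc c) f = cong (_+_ (f zero)) (∑-adjSwap n c (f ∘ suc))

adjSwap-inject₁ : ∀ {n} (c : Fin n) → adjSwap c (inject₁ c) ≡ suc c
adjSwap-inject₁ zero    = refl
adjSwap-inject₁ (suc c) = cong suc (adjSwap-inject₁ c)

adjSwap-suc : ∀ {n} (c : Fin n) → adjSwap c (suc c) ≡ inject₁ c
adjSwap-suc zero    = refl
adjSwap-suc (suc c) = cong suc (adjSwap-suc c)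

adjSwap-fixed : ∀ {n} (c : Fin n) j → j ≢ inject₁ c → j ≢ suc c → adjSwap c j ≡ j
adjSwap-fixed zero    zero          j≢ _  = contradiction refl j≢
adjSwap-fixed zero    (suc zero)    _  j≢ = contradiction refl j≢
adjSwap-fixed zero    (suc (suc j)) _  _  = refl
adjSwap-fixed (suc c) zero          _  _  = refl
adjSwap-fixed (suc c) (suc j)       j≢₁ j≢₂ = cong suc (adjSwap-fixed c j (j≢₁ ∘ cong suc) (j≢₂ ∘ cong suc))

adjSwap-punchIn-inject₁ : ∀ {n} (c : Fin n) l → adjSwap c (punchIn (inject₁ c) l) ≡ punchIn (suc c) l
adjSwap-punchIn-inject₁ zero    zero    = refl
adjSwap-punchIn-inject₁ zero    (suc l) = refl
adjSwap-punchIn-inject₁ (suc c) zero    = refl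
adjSwap-punchIn-inject₁ (suc c) (suc l) = cong suc (adjSwap-punchIn-inject₁ c l)

adjSwap-punchIn-suc : ∀ {n} (c : Fin n) l → adjSwap c (punchIn (suc c) l) ≡ punchIn (inject₁ c) l
adjSwap-punchIn-suc zero    zero    = refl
adjSwap-punchIn-suc zero    (suc l) = refl
adjSwap-punchIn-suc (suc c) zero    = refl
adjSwap-punchIn-suc (suc c) (suc l) = cong suc (adjSwap-punchIn-suc c l)

adjSwap-punchIn : ∀ {m} (c : Fin (suc m)) j → j ≢ inject₁ c → j ≢ suc c →
  ∃ λ (c′ : Fin m) → ∀ l → adjSwap c (punchIn j l) ≡ punchIn j (adjSwap c′ l)
adjSwap-punchIn zero    zero       j≢ _  = contradiction refl j≢
adjSwap-punchIn zero    (suc zero) _  j≢ = contradiction refl j≢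
adjSwap-punchIn {suc m} zero (suc (suc j)) _ _ = zero , commute
  where
  commute : ∀ l → adjSwap zero (punchIn (suc (suc j)) l) ≡ punchIn (suc (suc j)) (adjSwap zero l)
  commute zero          = refl
  commute (suc zero)    = refl
  commute (suc (suc l)) = refl
adjSwap-punchIn (suc c) zero _ _ = c , λ _ → refl
adjSwap-punchIn {suc m} (suc c) (suc j) j≢₁ j≢₂ with adjSwap-punchIn c j (j≢₁ ∘ cong suc) (j≢₂ ∘ cong suc)
... | c′ , commute = suc c′ , commute′
  where
  commute′ : ∀ l → adjSwap (suc c) (punchIn (suc j) l) ≡ punchIn (suc j) (adjSwap (suc c′) l)
  commute′ zero    = refl
  commute′ (suc l) = cong suc (commute l)

det-adjSwap : ∀ n (A : Mat (suc n)) (c : Fin n) → det (suc n) (λ r k → A r (adjSwap c k)) ≡ - det (suc n) A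
det-adjSwap (suc n) A c = begin
  det (suc (suc n)) A′                                  ≡⟨ ∑-cong (suc (suc n)) term ⟩
  ∑ (suc (suc n)) (λ j → - cofactorTerm A (adjSwap c j)) ≡⟨ neg-distrib-∑ (suc (suc n)) (cofactorTerm A ∘ adjSwap c) ⟩
  - ∑ (suc (suc n)) (cofactorTerm A ∘ adjSwap c)        ≡⟨ cong -_ (∑-adjSwap (suc n) c (cofactorTerm A)) ⟩
  - det (suc (suc n)) A                                 ∎
  where
  open ≡-Reasoning
  A′ : Mat (suc (suc n))
  A′ r k = A r (adjSwap c k)
  neg-first : ∀ s a d → - s * a * d ≡ - (s * a * d)
  neg-first = solve-∀
  swapped : ∀ j j′ → adjSwap c j ≡ j′ → (∀ l → adjSwap c (punchIn j l) ≡ punchIn j′ l) →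
            sgn j ≡ - sgn j′ → cofactorTerm A′ j ≡ - cofactorTerm A (adjSwap c j)
  swapped j _ refl minors sign =
    trans (cong₂ (λ s d → s * A zero (adjSwap c j) * d) sign (det-cong (suc n) (λ k l → cong (A (suc k)) (minors l))))
          (neg-first (sgn (adjSwap c j)) (A zero (adjSwap c j)) _)
  fixed : ∀ j → j ≢ inject₁ c → j ≢ suc c → cofactorTerm A′ j ≡ - cofactorTerm A (adjSwap c j)
  fixed j j≢₁ j≢₂ with c′ , commute ← adjSwap-punchIn c j j≢₁ j≢₂ =
    trans (cong₂ (λ k d → sgn j * A zero k * d) (adjSwap-fixed c j j≢₁ j≢₂)
            (trans (det-cong (suc n) (λ k l → cong (A (suc k)) (commute l))) (det-adjSwap n (minor A j) c′)))
      (trans (sym (neg-distribʳ-* (sgn j * A zero j) _)) (cong (λ k → - cofactorTerm A k) (sym (adjSwap-fixed c j j≢₁ j≢₂))))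
  term : ∀ j → cofactorTerm A′ j ≡ - cofactorTerm A (adjSwap c j)
  term j with j Fin.≟ inject₁ c | j Fin.≟ suc c
  ... | yes refl | _        = swapped j (suc c) (adjSwap-inject₁ c) (adjSwap-punchIn-inject₁ c)
                                (trans (sgn-inject₁ c) (trans (sym (neg-involutive _)) (cong -_ (sym (sgn-suc c)))))
  ... | no _     | yes refl = swapped j (inject₁ c) (adjSwap-suc c) (adjSwap-punchIn-suc c)
                                (trans (sgn-suc c) (cong -_ (sym (sgn-inject₁ c))))
  ... | no j≢₁   | no j≢₂   = fixed j j≢₁ j≢₂

det-adjacent-equal : ∀ n (A : Mat (suc n)) (c : Fin n) → (∀ r → A r (inject₁ c) ≡ A r (suc c)) → det (suc n) A ≡ 0ℤ
det-adjacent-equal n A c cols≡ = i≡-i⇒i≡0 (trans (det-cong (suc n) unchanged) (det-adjSwap n A c))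
  where
  i≡-i⇒i≡0 : ∀ {i} → i ≡ - i → i ≡ 0ℤ
  i≡-i⇒i≡0 {+ zero} _ = refl
  unchanged : ∀ r k → A r k ≡ A r (adjSwap c k)
  unchanged r k with k Fin.≟ inject₁ c | k Fin.≟ suc c
  ... | yes refl | _        = trans (cols≡ r) (cong (A r) (sym (adjSwap-inject₁ c)))
  ... | no _     | yes refl = trans (sym (cols≡ r)) (cong (A r) (sym (adjSwap-suc c)))
  ... | no k≢₁   | no k≢₂   = cong (A r) (sym (adjSwap-fixed c k k≢₁ k≢₂))

-- induction on the position of the right-hand column, moved left by adjacent swaps
det-equal-columns-< : ∀ n (A : Mat (suc n)) p q {k} → toℕ q ≡ k → toℕ p ℕ.< toℕ q →
                      (∀ r → A r p ≡ A r q) → det (suc n) A ≡ 0ℤ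
det-equal-columns-< n A p (suc c) {suc k} q≡1+k p<q cols≡ with p Fin.≟ inject₁ c
... | yes refl = det-adjacent-equal n A c cols≡
... | no p≢c   = trans (sym (neg-involutive _)) (trans (cong -_ (sym (det-adjSwap n A c)))
      (cong -_ (det-equal-columns-< n A′ p (inject₁ c) (trans (Fin.toℕ-inject₁ c) (ℕ.suc-injective q≡1+k)) p<c cols′≡)))
  where
  A′ : Mat (suc n)
  A′ r k = A r (adjSwap c k)
  p<c : toℕ p ℕ.< toℕ (inject₁ c)
  p<c = subst (toℕ p ℕ.<_) (sym (Fin.toℕ-inject₁ c))
    (ℕ.≤∧≢⇒< (ℕ.≤-pred p<q) (λ p≡c → p≢c (Fin.toℕ-injective (trans p≡c (sym (Fin.toℕ-inject₁ c))))))
  p≢1+c : p ≢ suc c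
  p≢1+c p≡1+c = ℕ.<-irrefl (cong toℕ p≡1+c) p<q
  cols′≡ : ∀ r → A′ r p ≡ A′ r (inject₁ c)
  cols′≡ r = trans (cong (A r) (adjSwap-fixed c p p≢c p≢1+c)) (trans (cols≡ r) (cong (A r) (sym (adjSwap-inject₁ c))))

det-equal-columns : ∀ n (A : Mat n) (p q : Fin n) → p ≢ q → (∀ r → A r p ≡ A r q) → det n A ≡ 0ℤ
det-equal-columns (suc n) A p q p≢q cols≡ with ℕ.<-cmp (toℕ p) (toℕ q)
... | tri< p<q _ _ = det-equal-columns-< n A p q refl p<q cols≡
... | tri≈ _ p≡q _ = contradiction (Fin.toℕ-injective p≡q) p≢q
... | tri> _ _ q<p = det-equal-columns-< n A q p refl q<p (sym ∘ cols≡)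

replaceColumn : ∀ {n} → Mat n → Fin n → Vecℤ n → Mat n
replaceColumn A j y r c = if does (c Fin.≟ j) then lookup y r else A r c

module _ {n : ℕ} (A : Mat n) (j : Fin n) where

  replaceColumn-≢ : ∀ y r {c} → c ≢ j → replaceColumn A j y r c ≡ A r c
  replaceColumn-≢ y r {c} c≢j with c Fin.≟ j
  ... | yes c≡j = contradiction c≡j c≢j
  ... | no  _   = refl

  replaceColumn-≡ : ∀ y r → replaceColumn A j y r j ≡ lookup y r
  replaceColumn-≡ y r with j Fin.≟ j
  ... | yes _   = refl
  ... | no  j≢j = contradiction refl j≢j

  det-replaceColumn-+ᵥ : ∀ u v → det n (replaceColumn A j (u +ᵥ v)) ≡ det n (replaceColumn A j u) + det n (replaceColumn A j v)
  det-replaceColumn-+ᵥ u v = det-additive-column n _ _ _ j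
    (λ r c c≢j → trans (replaceColumn-≢ (u +ᵥ v) r c≢j) (sym (replaceColumn-≢ u r c≢j)) ,
                 trans (replaceColumn-≢ (u +ᵥ v) r c≢j) (sym (replaceColumn-≢ v r c≢j)))
    (λ r → trans (replaceColumn-≡ (u +ᵥ v) r)
             (trans (lookup-+ᵥ u v r) (sym (cong₂ _+_ (replaceColumn-≡ u r) (replaceColumn-≡ v r)))))

  det-replaceColumn-·ᵥ : ∀ t u → det n (replaceColumn A j (t ·ᵥ u)) ≡ t * det n (replaceColumn A j u)
  det-replaceColumn-·ᵥ t u = det-scale-column n _ _ j t
    (λ r c c≢j → trans (replaceColumn-≢ (t ·ᵥ u) r c≢j) (sym (replaceColumn-≢ u r c≢j)))
    (λ r → trans (replaceColumn-≡ (t ·ᵥ u) r) (trans (lookup-·ᵥ t u r) (cong (t *_) (sym (replaceColumn-≡ u r)))))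

  det-replaceColumn-∑ᵥ : ∀ k (v : Fin k → Vecℤ n) →
    det n (replaceColumn A j (∑ᵥ k v)) ≡ ∑ k (λ l → det n (replaceColumn A j (v l)))
  det-replaceColumn-∑ᵥ zero v =
    trans (cong (det n ∘ replaceColumn A j) (sym (·ᵥ-zeroʳ 0ℤ))) (det-replaceColumn-·ᵥ 0ℤ 0ᵥ)
  det-replaceColumn-∑ᵥ (suc k) v =
    trans (det-replaceColumn-+ᵥ (v zero) (∑ᵥ k (v ∘ suc)))
          (cong (_+_ (det n (replaceColumn A j (v zero)))) (det-replaceColumn-∑ᵥ k (v ∘ suc)))

  cramer : ∀ x → det n (replaceColumn A j (A *ᵥ x)) ≡ lookup x j * det n A
  cramer x = begin
    det n (replaceColumn A j (A *ᵥ x))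
      ≡⟨ cong (det n ∘ replaceColumn A j) (*ᵥ≡∑ᵥ-columns A x) ⟩
    det n (replaceColumn A j (∑ᵥ n (λ l → lookup x l ·ᵥ col A l)))
      ≡⟨ det-replaceColumn-∑ᵥ n _ ⟩
    ∑ n (λ l → det n (replaceColumn A j (lookup x l ·ᵥ col A l)))
      ≡⟨ ∑-cong n (λ l → det-replaceColumn-·ᵥ (lookup x l) (col A l)) ⟩
    ∑ n (λ l → lookup x l * det n (replaceColumn A j (col A l)))
      ≡⟨ ∑-single n _ j other-columns ⟩
    lookup x j * det n (replaceColumn A j (col A j))
      ≡⟨ cong (lookup x j *_) (det-cong n same-matrix) ⟩
    lookup x j * det n A ∎
    where
    open ≡-Reasoning
    other-columns : ∀ l → l ≢ j → lookup x l * det n (replaceColumn A j (col A l)) ≡ 0ℤ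
    other-columns l l≢j = trans (cong (lookup x l *_) (det-equal-columns n _ l j l≢j λ r →
        trans (replaceColumn-≢ (col A l) r l≢j) (trans (sym (lookup-col A l r)) (sym (replaceColumn-≡ (col A l) r)))))
      (*-zeroʳ (lookup x l))
    same-matrix : ∀ r c → replaceColumn A j (col A j) r c ≡ A r c
    same-matrix r c with c Fin.≟ j
    ... | yes refl = lookup-col A c r
    ... | no  _    = refl

  cramer-∣ : ∀ {g} x → (∀ i → g ∣ lookup (A *ᵥ x) i) → g ∣ lookup x j * det n A
  cramer-∣ {g} x g∣Ax = subst (g ∣_) (cramer x)
    (det-column-∣ n _ j (λ r → subst (g ∣_) (sym (replaceColumn-≡ (A *ᵥ x) r)) (g∣Ax r)))

module _ {n : ℕ} (M : Mat n) (M-sym : Symmetric M) (M-pd : PosDef M) (a : ℤ) where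

  Rep-card : ∀ U → Injective _≡_ _≡_ (U *ᵥ_) → ∃ (HasCard (Rep a (congr M U)))
  Rep-card U U-injective =
    card-exists (λ c → Q (congr M U) c ≟ a) (proj₁ cover , λ c Qc≡a → proj₂ cover c (≤-reflexive Qc≡a))
    where
    cover : ListCover (λ c → Q (congr M U) c ≤ a)
    cover = Q≤-cover n (congr M U) (congr-symmetric M M-sym U) (congr-posDef M M-pd U U-injective) a

  basis-card : ∀ {P U} → IsSubmodule P → IsBasis U P →
               ∃ λ k → HasCard (Rep a (congr M U)) k × HasCard (λ x → P x × Rep a M x) k
  basis-card {P} {U} P-sub (cols∈ , spans , U-injective) =
    let (k , Rep-U) = Rep-card U (λ {c} {c′} → U-injective c c′) in
    k , Rep-U , card-image (U *ᵥ_) (λ {c} {c′} → U-injective c c′)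
      (λ {c} Qc≡a → IsSubmodule.*ᵥ-closed P-sub cols∈ c , trans (sym (Q-congr M U c)) Qc≡a)
      (λ {x} (x∈ , Qx≡a) → let (c , Uc≡x) = spans x x∈ in
        c , trans (Q-congr M U c) (trans (cong (Q M) Uc≡x) Qx≡a) , Uc≡x)
      Rep-U

module Cosets {n : ℕ} (B : Mat n) (s w y : Vecℤ n) (y∈ : 𝓜 B w s y) where

  L : Vecℤ n → Set
  L = 𝓜 B 0ᵥ s

  T : Vecℤ n → Set
  T = ℤ· y ⊕ L

  L-sub : IsSubmodule L
  L-sub = 𝓜-0ᵥ-isSubmodule B s

  open SameCosetProperties L-sub
  open IsSubmodule L-sub using (negᵥ-closed)

  -y∈ : 𝓜 B (negᵥ w) s (negᵥ y)
  -y∈ = 𝓜-negᵥ B s {w} {y} y∈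

  L⊆T : ∀ {x} → L x → T x
  L⊆T = ⊕-inj₂ L-sub y

  𝓜⊆T : ∀ {u z} → 𝓜 B u s z → T z → ∀ {x} → 𝓜 B u s x → T x
  𝓜⊆T {u} {z} z∈ z∈T {x} x∈ = ⊕-sameCoset L-sub y (𝓜⇒sameCoset B s {u} {x} {z} x∈ z∈) z∈T

  w⊆T : ∀ {x} → 𝓜 B w s x → T x
  w⊆T = 𝓜⊆T {w} {y} y∈ (⊕-generator L-sub y)

  -w⊆T : ∀ {x} → 𝓜 B (negᵥ w) s x → T x
  -w⊆T = 𝓜⊆T {negᵥ w} {negᵥ y} -y∈ (IsSubmodule.negᵥ-closed (⊕-isSubmodule L-sub y) {y} (⊕-generator L-sub y))

  y∉L : ∀ {d} → HasIndex T L (suc (suc d)) → ¬ L y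
  y∉L index y∈L = contradiction (index-≤ L-sub index (λ (_ : Fin 1) → 0ᵥ) single-coset) λ { (ℕ.s≤s ()) }
    where
    single-coset : ∀ {x} → T x → ∃ λ k → SameCoset L x 0ᵥ
    single-coset x∈T = zero , ∈⇒sameCoset-0ᵥ (⊕⊆ L-sub y y∈L x∈T)

  -y∉L : ¬ L y → ¬ L (negᵥ y)
  -y∉L y∉L -y∈L = y∉L (subst L (negᵥ-involutive y) (negᵥ-closed {negᵥ y} -y∈L))

  2y∉L : HasIndex T L 3 → ¬ SameCoset L y (negᵥ y)
  2y∉L index 2y∈L = contradiction (index-≤ L-sub index (λ k → (+ toℕ k) ·ᵥ y) (⊕-parity L-sub y 2y∈L))
    λ { (ℕ.s≤s (ℕ.s≤s ())) }

  module Index {d : ℕ} (reps : Fin d → Vecℤ n) (reps∈T : ∀ i → T (reps i))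
               (distinct : ∀ i j → SameCoset L (reps i) (reps j) → i ≡ j) (index : HasIndex T L d) where

    classify : ∀ {x} → T x → ∃ λ i → SameCoset L x (reps i)
    classify = index-cover L-sub index reps reps∈T distinct

    unique : ∀ {x} i j → SameCoset L x (reps i) → SameCoset L x (reps j) → i ≡ j
    unique {x} i j x∼i x∼j = distinct i j (sameCoset-trans (sameCoset-sym x∼i) x∼j)

  module Index₂ (index : HasIndex T L 2) where

    reps : Fin 2 → Vecℤ n
    reps zero       = 0ᵥ
    reps (suc zero) = y

    distinct : ∀ i j → SameCoset L (reps i) (reps j) → i ≡ j
    distinct zero       zero       _   = refl
    distinct zero       (suc zero) 0∼y = contradiction (sameCoset-0ᵥ⇒∈ (sameCoset-sym 0∼y)) (y∉L index)
    distinct (suc zero) zero       y∼0 = contradiction (sameCoset-0ᵥ⇒∈ y∼0) (y∉L index)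
    distinct (suc zero) (suc zero) _   = refl

    reps∈T : ∀ i → T (reps i)
    reps∈T zero       = L⊆T (IsSubmodule.0ᵥ-closed L-sub)
    reps∈T (suc zero) = ⊕-generator L-sub y

    open Index reps reps∈T distinct index

    ∉L⇒∈w : ∀ {x} → T x → ¬ L x → 𝓜 B w s x
    ∉L⇒∈w {x} x∈T x∉L = from-coset (classify x∈T)
      where
      from-coset : ∃ (λ i → SameCoset L x (reps i)) → 𝓜 B w s x
      from-coset (zero     , x∼0) = contradiction (sameCoset-0ᵥ⇒∈ x∼0) x∉L
      from-coset (suc zero , x∼y) = sameCoset⇒𝓜 B s {w} y∈ x∼y

    ∈w⇒∉L : ∀ {x} → 𝓜 B w s x → ¬ L x
    ∈w⇒∉L {x} x∈ x∈L = contradiction (unique zero (suc zero) (∈⇒sameCoset-0ᵥ x∈L) (𝓜⇒sameCoset B s {w} {x} {y} x∈ y∈)) λ ()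

  module Index₃ (index : HasIndex T L 3) where

    reps : Fin 3 → Vecℤ n
    reps zero             = 0ᵥ
    reps (suc zero)       = y
    reps (suc (suc zero)) = negᵥ y

    distinct : ∀ i j → SameCoset L (reps i) (reps j) → i ≡ j
    distinct zero             zero             _ = refl
    distinct (suc zero)       (suc zero)       _ = refl
    distinct (suc (suc zero)) (suc (suc zero)) _ = refl
    distinct zero (suc zero) 0∼y = contradiction (sameCoset-0ᵥ⇒∈ (sameCoset-sym 0∼y)) (y∉L index)
    distinct (suc zero) zero y∼0 = contradiction (sameCoset-0ᵥ⇒∈ y∼0) (y∉L index)
    distinct zero (suc (suc zero)) 0∼-y =
      contradiction (sameCoset-0ᵥ⇒∈ (sameCoset-sym 0∼-y)) (-y∉L (y∉L index))
    distinct (suc (suc zero)) zero -y∼0 = contradiction (sameCoset-0ᵥ⇒∈ -y∼0) (-y∉L (y∉L index))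
    distinct (suc zero) (suc (suc zero)) y∼-y = contradiction y∼-y (2y∉L index)
    distinct (suc (suc zero)) (suc zero) -y∼y = contradiction (sameCoset-sym -y∼y) (2y∉L index)

    reps∈T : ∀ i → T (reps i)
    reps∈T zero             = L⊆T (IsSubmodule.0ᵥ-closed L-sub)
    reps∈T (suc zero)       = ⊕-generator L-sub y
    reps∈T (suc (suc zero)) = -w⊆T {negᵥ y} -y∈

    open Index reps reps∈T distinct index

    ∉L∉w⇒∈-w : ∀ {x} → T x → ¬ L x → ¬ 𝓜 B w s x → 𝓜 B (negᵥ w) s x
    ∉L∉w⇒∈-w {x} x∈T x∉L x∉w = from-coset (classify x∈T)
      where
      from-coset : ∃ (λ i → SameCoset L x (reps i)) → 𝓜 B (negᵥ w) s x
      from-coset (zero           , x∼0)  = contradiction (sameCoset-0ᵥ⇒∈ x∼0) x∉L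
      from-coset (suc zero       , x∼y)  = contradiction (sameCoset⇒𝓜 B s {w} y∈ x∼y) x∉w
      from-coset (suc (suc zero) , x∼-y) = sameCoset⇒𝓜 B s {negᵥ w} -y∈ x∼-y

    ∈w⇒∉L : ∀ {x} → 𝓜 B w s x → ¬ L x
    ∈w⇒∉L {x} x∈ x∈L =
      contradiction (unique zero (suc zero) (∈⇒sameCoset-0ᵥ x∈L) (𝓜⇒sameCoset B s {w} {x} {y} x∈ y∈)) λ ()

    ∈-w⇒∉L : ∀ {x} → 𝓜 B (negᵥ w) s x → ¬ L x
    ∈-w⇒∉L {x} x∈ x∈L =
      contradiction (unique zero (suc (suc zero)) (∈⇒sameCoset-0ᵥ x∈L) (𝓜⇒sameCoset B s {negᵥ w} {x} {negᵥ y} x∈ -y∈)) λ ()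

    ∈-w⇒∉w : ∀ {x} → 𝓜 B (negᵥ w) s x → ¬ 𝓜 B w s x
    ∈-w⇒∉w {x} x∈-w x∈w = contradiction (unique (suc zero) (suc (suc zero))
      (𝓜⇒sameCoset B s {w} {x} {y} x∈w y∈) (𝓜⇒sameCoset B s {negᵥ w} {x} {negᵥ y} x∈-w -y∈)) λ ()

module _ {n : ℕ} (B : Mat n) (w s : Vecℤ n) (a : ℤ) (M : Mat n) where

  R-negᵥ : ∀ x → R B w s a M x → R B (negᵥ w) s a M (negᵥ x)
  R-negᵥ x (x∈ , Qx≡a) = 𝓜-negᵥ B s {w} {x} x∈ , trans (Q-negᵥ M x) Qx≡a

  negᵥ-injective : Injective _≡_ _≡_ (negᵥ {n})
  negᵥ-injective {x} {x′} -x≡-x′ = trans (sym (negᵥ-involutive x)) (trans (cong negᵥ -x≡-x′) (negᵥ-involutive x′))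

  R-negᵥ-surjective : ∀ z → R B (negᵥ w) s a M z → ∃ λ x → R B w s a M x × negᵥ x ≡ z
  R-negᵥ-surjective z (z∈ , Qz≡a) =
    negᵥ z ,
    (subst (λ u → 𝓜 B u s (negᵥ z)) (negᵥ-involutive w) (𝓜-negᵥ B s {negᵥ w} {z} z∈) , trans (Q-negᵥ M z) Qz≡a) ,
    negᵥ-involutive z

  card-R-negᵥ : ∀ {k} → HasCard (R B w s a M) k → HasCard (R B (negᵥ w) s a M) k
  card-R-negᵥ = card-image negᵥ negᵥ-injective (λ {x} → R-negᵥ x) (λ {z} → R-negᵥ-surjective z)

module CosetCounts {n : ℕ} (M B : Mat n) (a : ℤ) (s w y : Vecℤ n) (y∈ : 𝓜 B w s y) where
  open Cosets B s w y y∈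

  split-off-L : ∀ {k₂ k₃} → HasCard (λ x → T x × Rep a M x) k₂ → HasCard (λ x → L x × Rep a M x) k₃ →
                ∃ λ k → HasCard (λ x → (T x × Rep a M x) × ¬ L x) k × k₃ ℕ.+ k ≡ k₂
  split-off-L {k₂} Rep-T Rep-L =
    let (k₃′ , k , Rep-T∩L , Rep-T∖L , k₃′+k≡k₂) = card-split (𝓜? B s 0ᵥ) Rep-T
        Rep-L′ = card-resp (λ ((_ , Qx≡a) , x∈L) → x∈L , Qx≡a) (λ (x∈L , Qx≡a) → (L⊆T x∈L , Qx≡a) , x∈L) Rep-T∩L
    in k , Rep-T∖L , subst (λ k₃ → k₃ ℕ.+ k ≡ k₂) (card-unique Rep-L′ Rep-L) k₃′+k≡k₂

  count₂ : HasIndex T L 2 → ∀ {k₂ k₃} → HasCard (λ x → T x × Rep a M x) k₂ → HasCard (λ x → L x × Rep a M x) k₃ →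
           ∃ λ k₁ → HasCard (R B w s a M) k₁ × k₁ ℕ.+ k₃ ≡ k₂
  count₂ index Rep-T Rep-L =
    let (k₁ , Rep-T∖L , k₃+k₁≡k₂) = split-off-L Rep-T Rep-L
    in k₁ , card-resp (λ ((x∈T , Qx≡a) , x∉L) → ∉L⇒∈w x∈T x∉L , Qx≡a) (λ {x} (x∈ , Qx≡a) → (w⊆T {x} x∈ , Qx≡a) , ∈w⇒∉L {x} x∈) Rep-T∖L ,
       trans (ℕ.+-comm k₁ _) k₃+k₁≡k₂
    where open Index₂ index

  count₃ : HasIndex T L 3 → ∀ {k₂ k₃} → HasCard (λ x → T x × Rep a M x) k₂ → HasCard (λ x → L x × Rep a M x) k₃ →
           ∃ λ k₁ → HasCard (R B w s a M) k₁ × 2 ℕ.* k₁ ℕ.+ k₃ ≡ k₂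
  count₃ index {k₂} {k₃} Rep-T Rep-L =
    let (k , Rep-T∖L , k₃+k≡k₂) = split-off-L Rep-T Rep-L
        (k₁ , k₁′ , Rep-w , Rep-¬w , k₁+k₁′≡k) = card-split (𝓜? B s w) Rep-T∖L
        R-w = card-resp (λ (((_ , Qx≡a) , _) , x∈) → x∈ , Qx≡a)
                        (λ {x} (x∈ , Qx≡a) → ((w⊆T {x} x∈ , Qx≡a) , ∈w⇒∉L {x} x∈) , x∈) Rep-w
        R-¬w = card-resp (λ (((x∈T , Qx≡a) , x∉L) , x∉w) → ∉L∉w⇒∈-w x∈T x∉L x∉w , Qx≡a)
                         (λ {x} (x∈ , Qx≡a) → ((-w⊆T {x} x∈ , Qx≡a) , ∈-w⇒∉L {x} x∈) , ∈-w⇒∉w {x} x∈) Rep-¬w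
    in k₁ , R-w , total (card-unique (card-R-negᵥ B w s a M R-w) R-¬w) k₁+k₁′≡k k₃+k≡k₂
    where
    open Index₃ index
    total : ∀ {k₁ k₁′ k} → k₁ ≡ k₁′ → k₁ ℕ.+ k₁′ ≡ k → k₃ ℕ.+ k ≡ k₂ → 2 ℕ.* k₁ ℕ.+ k₃ ≡ k₂
    total {k₁} refl refl refl = trans (cong (λ k → (k₁ ℕ.+ k) ℕ.+ k₃) (ℕ.+-identityʳ k₁)) (ℕ.+-comm _ k₃)

gcdᵥ-∣ : ∀ n (s : Vecℤ n) i → gcdᵥ n s ∣ lookup s i
gcdᵥ-∣ (suc n) s zero    = ∣ᵤ⇒∣ (gcd[i,j]∣i (lookup s zero) (gcdᵥ n (tabulate (lookup s ∘ suc))))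
gcdᵥ-∣ (suc n) s (suc i) = ∣-trans (∣ᵤ⇒∣ (gcd[i,j]∣j (lookup s zero) (gcdᵥ n (tabulate (lookup s ∘ suc)))))
  (subst (gcdᵥ n (tabulate (lookup s ∘ suc)) ∣_) (Vec.lookup∘tabulate (lookup s ∘ suc) i) (gcdᵥ-∣ n _ i))

∣-coprime-∣ : ∀ {g m c x} → g ∣ m → gcd c m ≡ + 1 → g ∣ x * c → g ∣ x
∣-coprime-∣ {g} {m} {c} {x} g∣m gcd≡1 g∣xc =
  ∣ᵤ⇒∣ (ℕ.coprime-divisor coprime (subst (∣ g ∣ ℕ.∣_) (trans (abs-* x c) (ℕ.*-comm ∣ x ∣ ∣ c ∣)) (∣⇒∣ᵤ g∣xc)))
  where
  coprime : ℕ.Coprime ∣ g ∣ ∣ c ∣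
  coprime {d} (d∣g , d∣c) = ℕ.∣1⇒≡1 (subst (d ℕ.∣_) (+-injective gcd≡1) (ℕ.gcd-greatest d∣c (ℕ.∣-trans d∣g (∣⇒∣ᵤ g∣m))))

∣-coprime-unit : ∀ {g m c} → g ∣ m → gcd c m ≡ + 1 → g ∣ c → ∣ g ∣ ≡ 1
∣-coprime-unit {g} {m} {c} g∣m gcd≡1 g∣c =
  ℕ.∣1⇒≡1 (subst (λ d → ∣ g ∣ ℕ.∣ ∣ d ∣) gcd≡1 (gcd-greatest {c} {m} {g} (∣⇒∣ᵤ g∣c) (∣⇒∣ᵤ g∣m)))

-- g = gcd(s, k) divides B x, hence (being prime to det B) every xⱼ, hence Q M x = a
no-representations : ∀ n (M B : Mat n) a (w s : Vecℤ n) →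
  gcd (det n B) (gcdᵥ n s) ≡ + 1 → gcd a (gcdᵥ n s) ≡ + 1 →
  ∀ k → + 1 < gcd (gcdᵥ n s) k → ¬ ∃ (R B (k ·ᵥ w) s a M)
no-representations n M B a w s det-coprime a-coprime k (+<+ 1<g) (x , x∈ , Qx≡a) =
  ℕ.<-irrefl (sym (∣-coprime-unit g∣s* a-coprime g∣a)) 1<g
  where
  g : ℤ
  g = gcd (gcdᵥ n s) k
  g∣s* : g ∣ gcdᵥ n s
  g∣s* = ∣ᵤ⇒∣ (gcd[i,j]∣i (gcdᵥ n s) k)
  g∣k : g ∣ k
  g∣k = ∣ᵤ⇒∣ (gcd[i,j]∣j (gcdᵥ n s) k)
  g∣Bx : ∀ i → g ∣ lookup (B *ᵥ x) i
  g∣Bx i = subst (g ∣_) (cancel (lookup (B *ᵥ x) i) (lookup (k ·ᵥ w) i))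
    (∣m∣n⇒∣m+n (∣-trans (∣-trans g∣s* (gcdᵥ-∣ n s i)) (≡-mod⇒∣ s {B *ᵥ x} {k ·ᵥ w} x∈ i))
      (subst (g ∣_) (sym (lookup-·ᵥ k w i)) (∣m⇒∣m*n (lookup w i) g∣k)))
    where
    cancel : ∀ a b → (a - b) + b ≡ a
    cancel = solve-∀
  g∣a : g ∣ a
  g∣a = subst (g ∣_) Qx≡a (Q-∣ M x λ j → ∣-coprime-∣ g∣s* det-coprime (cramer-∣ B j x g∣Bx))

corollary3p3 :
    (n : ℕ) (M B : Mat n) (a : ℤ) (w s : Vecℤ n) →
    Symmetric M → PosDef M →
    (∀ i → ¬ (lookup s i ≡ 0ℤ)) →
    ∃ (𝓜 B w s) →
    -- (i)
    ((U : Mat n) → IsBasis U (𝓜 B 0ᵥ s) →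
      ∃ λ k → HasCard (R B 0ᵥ s a M) k × HasCard (Rep a (congr M U)) k)
    -- (ii)
    × ((U : Mat n) → IsBasis U (𝓜 B 0ᵥ s) →
       (y : Vecℤ n) → 𝓜 B w s y →
       (V : Mat n) → IsBasis V (ℤ· y ⊕ 𝓜 B 0ᵥ s) →
       HasIndex (ℤ· y ⊕ 𝓜 B 0ᵥ s) (𝓜 B 0ᵥ s) 2 →
       Σ ℕ λ k₁ → Σ ℕ λ k₂ → Σ ℕ λ k₃ →
         HasCard (R B w s a M) k₁ × HasCard (Rep a (congr M V)) k₂
         × HasCard (Rep a (congr M U)) k₃ × k₁ ℕ.+ k₃ ≡ k₂)
    -- (iii) x ↦ -x is a bijection R_{B,w} → R_{B,-w}
    × ((∀ x → R B w s a M x → R B (negᵥ w) s a M (negᵥ x))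
       × (∀ x x' → R B w s a M x → R B w s a M x' → negᵥ x ≡ negᵥ x' → x ≡ x')
       × (∀ z → R B (negᵥ w) s a M z → ∃ λ x → R B w s a M x × negᵥ x ≡ z))
    -- (iii) the case d = 3
    × ((U : Mat n) → IsBasis U (𝓜 B 0ᵥ s) →
       (y : Vecℤ n) → 𝓜 B w s y →
       (V : Mat n) → IsBasis V (ℤ· y ⊕ 𝓜 B 0ᵥ s) →
       HasIndex (ℤ· y ⊕ 𝓜 B 0ᵥ s) (𝓜 B 0ᵥ s) 3 →
       Σ ℕ λ k₁ → Σ ℕ λ k₂ → Σ ℕ λ k₃ →
         HasCard (R B w s a M) k₁ × HasCard (Rep a (congr M V)) k₂
         × HasCard (Rep a (congr M U)) k₃ × 2 ℕ.* k₁ ℕ.+ k₃ ≡ k₂)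
    -- (iv)
    × (gcd (det n B) (gcdᵥ n s) ≡ + 1 → gcd a (gcdᵥ n s) ≡ + 1 →
       (k : ℤ) → + 1 < gcd (gcdᵥ n s) k →
       ¬ ∃ (R B (k ·ᵥ w) s a M))
-- nonemptiness of 𝓜_{B,w} enters through y ∈ 𝓜 B w s
corollary3p3 n M B a w s M-sym M-pd _ _ =
    (λ U U-basis → let (k , Rep-U , Rep-L) = card-via-basis L-sub U-basis in k , Rep-L , Rep-U)
  , (λ U U-basis y y∈ V V-basis index →
      let (k₃ , Rep-U , Rep-L) = card-via-basis L-sub U-basis
          (k₂ , Rep-V , Rep-T) = card-via-basis (⊕-isSubmodule L-sub y) V-basis
          (k₁ , R-w , k₁+k₃≡k₂) = CosetCounts.count₂ M B a s w y y∈ index Rep-T Rep-L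
      in k₁ , k₂ , k₃ , R-w , Rep-V , Rep-U , k₁+k₃≡k₂)
  , (R-negᵥ B w s a M , (λ _ _ _ _ → negᵥ-injective B w s a M) , R-negᵥ-surjective B w s a M)
  , (λ U U-basis y y∈ V V-basis index →
      let (k₃ , Rep-U , Rep-L) = card-via-basis L-sub U-basis
          (k₂ , Rep-V , Rep-T) = card-via-basis (⊕-isSubmodule L-sub y) V-basis
          (k₁ , R-w , 2k₁+k₃≡k₂) = CosetCounts.count₃ M B a s w y y∈ index Rep-T Rep-L
      in k₁ , k₂ , k₃ , R-w , Rep-V , Rep-U , 2k₁+k₃≡k₂)
  , no-representations n M B a w s
  where
  L-sub : IsSubmodule (𝓜 B 0ᵥ s)
  L-sub = 𝓜-0ᵥ-isSubmodule B s
  card-via-basis : ∀ {P U} → IsSubmodule P → IsBasis U P →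
                   ∃ λ k → HasCard (Rep a (congr M U)) k × HasCard (λ x → P x × Rep a M x) k
  card-via-basis = basis-card M M-sym M-pd a
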